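{- Let $b=(b_0,b_1,\ldots)$ and $\lambda=(\lambda_0,\lambda_1,\ldots)$ be the sequences with $b_0=\lambda_0=1$ and, for $n\geq1$, \[ b_n = 3-\frac{1}{F_{2n-1}F_{2n-3}}, \qquad \lambda_n = 1+\frac{1}{F_{2n-1}^2}, \] where $F_m$ are the Fibonacci numbers ($F_0=0$, $F_1=1$, $F_m=F_{m-1}+F_{m-2}$ for all integers $m$, so $F_{ -1}=1$). Then for every $n\geq 0$, \[ \#\mathrm{NC}_2(n) = \mathrm{Mot}_n(b,\lambda). \]
   Context: A Motzkin path of length $n$ is a lattice path from $(0,0)$ to $(n,0)$ with steps $U=(1,1)$, $D=(1,-1)$, $H=(1,0)$ never going below the $x$-axis. The height of a step is the $y$-coordinate of its ending point. Given sequences $b=(b_0,b_1,\ldots)$ and $\lambda=(\lambda_0,\lambda_1,\ldots)$, the weight of a Motzkin path is the product of $b_i$ over its horizontal steps of height $i$ and $\lambda_i$ over its down steps of height $i$ (up steps have weight $1$); $\mathrm{Mot}_n(b,\lambda)$ is the sum of weights of all Motzkin paths of length $n$. For a set partition of $[n]=\{1,\ldots,n\}$, an arc is a pair $(i,j)$ with $i<j$ in the same block such that the block contains no integer strictly between $i$ and $j$. A $2$-distant noncrossing partition of $[n]$ is a set partition of $[n]$ having no two arcs $(a,c)$ and $(b,d)$ with $a<b\leq c<d$ and $c-b\geq 2$. $\mathrm{NC}_2(n)$ denotes the set of $2$-distant noncrossing partitions of $[n]$. -}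

module Defs where

open import Data.Bool using (Bool; true; false; _∧_; _∨_; not; if_then_else_)
open import Data.Nat as ℕ using (ℕ; zero; suc; _<ᵇ_; _≤ᵇ_; _≡ᵇ_)
open import Data.Integer as ℤ using (ℤ; +_; -[1+_])
open import Data.Fin using (Fin; toℕ)
open import Data.List using (List; []; _∷_; map; concatMap; filter; length; allFin; foldr)
open import Data.Bool.ListAction using (all; any)
open import Data.Vec.Functional using () renaming (_∷_ to _∷ᶠ_)
open import Data.Rational as ℚ using (ℚ; 0ℚ; 1ℚ; _+_; _*_; _-_; 1/_; _≟_)
open import Relation.Nullary using (yes; no)
open import Relation.Unary using (Decidable)
open import Relation.Nullary.Decidable using (True; ⌊_⌋)
open import Relation.Binary.PropositionalEquality using (_≡_)

fib : ℕ → ℕ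
fib zero = 0
fib (suc zero) = 1
fib (suc (suc n)) = fib (suc n) ℕ.+ fib n

-- F_{-(m+1)} = (-1)^m F_{m+1}
F : ℤ → ℤ
F (+ n) = + fib n
F -[1+ m ] = sign m (+ fib (suc m))
  where
  sign : ℕ → ℤ → ℤ
  sign zero x = x
  sign (suc zero) x = ℤ.- x
  sign (suc (suc k)) x = sign k x

toℚ : ℤ → ℚ
toℚ z = z ℚ./ 1

-- reciprocal, total (1/0 := 0 convention; only ever applied to nonzero values here)
inv : ℚ → ℚ
inv p with p ≟ 0ℚ
... | yes _ = 0ℚ
... | no p≢0 = 1/_ p {{ℚ.≢-nonZero p≢0}}

F2n- : ℕ → ℕ → ℤ
F2n- n k = F ((+ (2 ℕ.* n)) ℤ.- (+ k))

bSeq : ℕ → ℚ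
bSeq zero = 1ℚ
bSeq (suc n) = toℚ (+ 3) - inv (toℚ (F2n- (suc n) 1 ℤ.* F2n- (suc n) 3))

λSeq : ℕ → ℚ
λSeq zero = 1ℚ
λSeq (suc n) = 1ℚ + inv (toℚ (F2n- (suc n) 1 ℤ.* F2n- (suc n) 1))

data Step : Set where
  U D H : Step

allSteps : List Step
allSteps = U ∷ D ∷ H ∷ []

words : ℕ → List (List Step)
words zero = [] ∷ []
words (suc n) = concatMap (λ s → map (s ∷_) (words n)) allSteps

isMotzkinFrom : ℕ → List Step → Bool
isMotzkinFrom h [] = h ≡ᵇ 0
isMotzkinFrom h (U ∷ w) = isMotzkinFrom (suc h) w
isMotzkinFrom zero (D ∷ w) = false
isMotzkinFrom (suc h) (D ∷ w) = isMotzkinFrom h w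
isMotzkinFrom h (H ∷ w) = isMotzkinFrom h w

-- weight of a path starting at height h: a step's height is the height of its
-- END point; H at height i contributes b i, D ending at height i contributes λ i
weightFrom : (ℕ → ℚ) → (ℕ → ℚ) → ℕ → List Step → ℚ
weightFrom b λ' h [] = 1ℚ
weightFrom b λ' h (U ∷ w) = weightFrom b λ' (suc h) w
weightFrom b λ' zero (D ∷ w) = 0ℚ   -- never reached on Motzkin paths
weightFrom b λ' (suc h) (D ∷ w) = λ' h * weightFrom b λ' h w
weightFrom b λ' h (H ∷ w) = b h * weightFrom b λ' h w

motzkinPaths : ℕ → List (List Step)
motzkinPaths n = filter (λ w → isMotzkinFrom 0 w Data.Bool.≟ true) (words n)
  where import Data.Bool

Mot : ℕ → (ℕ → ℚ) → (ℕ → ℚ) → ℚ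
Mot n b λ' = foldr _+_ 0ℚ (map (weightFrom b λ' 0) (motzkinPaths n))

-- Set partitions of [n] (elements 0..n-1 of Fin n, order-preserving
-- relabelling of 1..n), represented as equivalence relations on Fin n

Rel : ℕ → Set
Rel n = Fin n → Fin n → Bool

allFuns : {A : Set} → List A → (n : ℕ) → List (Fin n → A)
allFuns xs zero = (λ ()) ∷ []
allFuns xs (suc n) = concatMap (λ x → map (x ∷ᶠ_) (allFuns xs n)) xs

allRels : (n : ℕ) → List (Rel n)
allRels n = allFuns (allFuns (true ∷ false ∷ []) n) n

∀F : (n : ℕ) → (Fin n → Bool) → Bool
∀F n p = all p (allFin n)

∃F : (n : ℕ) → (Fin n → Bool) → Bool
∃F n p = any p (allFin n)

_⇒_ : Bool → Bool → Bool
x ⇒ y = not x ∨ y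

_<F_ : {n : ℕ} → Fin n → Fin n → Bool
i <F j = toℕ i <ᵇ toℕ j

isEquivalence : {n : ℕ} → Rel n → Bool
isEquivalence {n} R =
  ∀F n (λ i → R i i) ∧
  ∀F n (λ i → ∀F n (λ j → R i j ⇒ R j i)) ∧
  ∀F n (λ i → ∀F n (λ j → ∀F n (λ k → (R i j ∧ R j k) ⇒ R i k)))

isArc : {n : ℕ} → Rel n → Fin n → Fin n → Bool
isArc {n} R i j = (i <F j) ∧ R i j ∧ not (∃F n (λ k → (i <F k) ∧ (k <F j) ∧ R i k))

is2DistantNoncrossing : {n : ℕ} → Rel n → Bool
is2DistantNoncrossing {n} R = not (∃F n λ a → ∃F n λ b → ∃F n λ c → ∃F n λ d →
  isArc R a c ∧ isArc R b d ∧ (a <F b) ∧ (toℕ b ≤ᵇ toℕ c) ∧ (c <F d)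
  ∧ (2 ≤ᵇ (toℕ c ℕ.∸ toℕ b)))

isNC2 : {n : ℕ} → Rel n → Bool
isNC2 R = isEquivalence R ∧ is2DistantNoncrossing R

numNC2 : ℕ → ℕ
numNC2 n = length (filter (λ R → isNC2 R Data.Bool.≟ true) (allRels n))
  where import Data.Bool

ℕtoℚ : ℕ → ℚ
ℕtoℚ n = toℚ (+ n)

-- Call an element m of a 2-distant noncrossing partition active if it is the least element of its
-- block and no arc (b, d) has b + 2 ≤ m < d. Prepending a new least element keeps a partition
-- 2-distant noncrossing exactly when the new element is a singleton or joins the block of an active
-- element, and the active elements of the result can be read off. Hence weightedCount n g, the sum
-- of g (number of active elements) over NC₂(n), satisfies
-- weightedCount (n + 1) g = weightedCount n (transfer g). In the basis e₀ = [k = 0],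
-- e (j + 1) k = C(k - 1, j) the operator transfer is tridiagonal with unit off-diagonal and diagonal
-- 2, 3, 3, …, and #NC₂(n) = q 0 + q 1 where q h = weightedCount n (e h). The combinations
-- r h · q h + q (h + 1), with r 0 = 1 and r h = F(2h+1)/F(2h-1), satisfy the recurrence of the
-- weighted Motzkin path sums from height h; the three coefficient identities this needs reduce to
-- Cassini's identity F(2k-1) F(2k+3) = F(2k+1)² + 1. At height 0 this is the theorem.

module Submission where

open import Algebra.Bundles using (Semiring; Ring)
open import Data.Bool as Bool using (Bool; true; false; T; _∧_; _∨_; not; if_then_else_)
open import Data.Bool.ListAction using (and; or)
open import Data.Bool.Properties as BoolP using (T-∧; T-∨; T-≡)
open import Data.Empty using (⊥; ⊥-elim)
open import Data.Fin as Fin using (Fin; zero; suc; toℕ)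
import Data.Fin.Properties as FinP
import Data.Integer as ℤ
import Data.Integer.Properties as ℤP
open import Data.List as List using (List; []; _∷_; map; concatMap; filter; foldr; length; _++_)
open import Data.List.Membership.Propositional using (lose)
open import Data.List.Membership.Propositional.Properties using (∈-allFin)
open import Data.List.Properties using (map-cong)
import Data.List.Relation.Unary.All as All
open import Data.List.Relation.Unary.All.Properties using (all⁺; all⁻)
import Data.List.Relation.Unary.Any as Any
open import Data.List.Relation.Unary.Any.Properties using (any⁺; any⁻)
open import Data.Nat as ℕ using (ℕ; zero; suc; z≤n; s≤s)
import Data.Nat.Coprimality as Coprime
import Data.Nat.Properties as ℕP
open import Data.Nat.Tactic.RingSolver using () renaming (ring to ℕ-ring)
open import Data.Product using (_×_; _,_; proj₁; proj₂; ∃-syntax)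
open import Data.Rational as ℚ using (ℚ; 0ℚ; 1ℚ)
import Data.Rational.Properties as ℚP
import Data.Rational.Unnormalised as ℚᵘ
import Data.Rational.Unnormalised.Properties as ℚᵘP
open import Data.Sum as Sum using (_⊎_; inj₁; inj₂)
open import Data.Vec.Functional using () renaming (_∷_ to _∷ᶠ_)
open import Function using (_∘_; _⇔_; mk⇔; Equivalence)
open import Level using (0ℓ)
open import Relation.Binary.Definitions using (tri<; tri≈; tri>)
open import Relation.Binary.PropositionalEquality as ≡ using (_≡_; _≢_; _≗_; refl)
open import Relation.Binary.Structures using (IsEquivalence)
open import Relation.Nullary using (¬_; yes; no)
open import Relation.Nullary.Decidable using (⌊_⌋; toWitness; fromWitness; dec⇒maybe)
open import Tactic.RingSolver using (solve-∀)
import Tactic.RingSolver.Core.AlmostCommutativeRing as ACR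

open import Defs

open Equivalence using (to; from)

T-injective : {x y : Bool} → (T x ⇔ T y) → x ≡ y
T-injective {true}  {true}  _   = refl
T-injective {true}  {false} x⇔y = ⊥-elim (to x⇔y _)
T-injective {false} {true}  x⇔y = ⊥-elim (from x⇔y _)
T-injective {false} {false} _   = refl

T-not : {x : Bool} → T (not x) ⇔ (¬ T x)
T-not {true}  = mk⇔ (λ ()) (λ ¬t → ¬t _)
T-not {false} = mk⇔ (λ _ ()) _

T-⇒ : {x y : Bool} → T (x ⇒ y) ⇔ (T x → T y)
T-⇒ {true}  = mk⇔ (λ t _ → t) (λ f → f _)
T-⇒ {false} = mk⇔ (λ _ ()) _

T-<F : {n : ℕ} {i j : Fin n} → T (i <F j) ⇔ i Fin.< j
T-<F {i = i} {j} = mk⇔ (ℕP.<ᵇ⇒< (toℕ i) (toℕ j)) ℕP.<⇒<ᵇ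

module _ {n : ℕ} {p : Fin n → Bool} where

  T-∀F : T (∀F n p) ⇔ (∀ i → T (p i))
  T-∀F = mk⇔ (λ t i → All.lookup (all⁺ p (List.allFin n) t) (∈-allFin i))
             (λ f → all⁻ p {List.allFin n} (All.tabulate (λ {i} _ → f i)))

  T-∃F : T (∃F n p) ⇔ (∃[ i ] T (p i))
  T-∃F = mk⇔ (λ t → Any.satisfied (any⁻ p (List.allFin n) t))
             (λ (i , t) → any⁺ p (lose (∈-allFin i) t))

  T-∄F : T (not (∃F n p)) ⇔ (∀ i → ¬ T (p i))
  T-∄F = mk⇔ (λ t i pi → to T-not t (from T-∃F (i , pi)))
             (λ f → from T-not (λ t → let (i , pi) = to T-∃F t in f i pi))

∀F-cong : (n : ℕ) {p q : Fin n → Bool} → p ≗ q → ∀F n p ≡ ∀F n q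
∀F-cong n p≗q = ≡.cong and (map-cong p≗q (List.allFin n))

∃F-cong : (n : ℕ) {p q : Fin n → Bool} → p ≗ q → ∃F n p ≡ ∃F n q
∃F-cong n p≗q = ≡.cong or (map-cong p≗q (List.allFin n))

infix 4 _≗ᵇ_

_≗ᵇ_ : {n : ℕ} → (Fin n → Bool) → (Fin n → Bool) → Bool
_≗ᵇ_ {zero} r s = true
_≗ᵇ_ {suc n} r s = ⌊ r zero Bool.≟ s zero ⌋ ∧ (r ∘ suc ≗ᵇ s ∘ suc)

T-≗ᵇ : {n : ℕ} {r s : Fin n → Bool} → T (r ≗ᵇ s) ⇔ r ≗ s
T-≗ᵇ {zero}  = mk⇔ (λ _ ()) _
T-≗ᵇ {suc n} = mk⇔
  (λ t → let (r₀≡s₀ , rest) = to T-∧ t in λ { zero → toWitness r₀≡s₀ ; (suc i) → to T-≗ᵇ rest i })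
  (λ r≗s → from T-∧ (fromWitness (r≗s zero) , from T-≗ᵇ (r≗s ∘ suc)))

if-T : {A : Set} {b : Bool} {x y : A} → T b → (if b then x else y) ≡ x
if-T {b = true} _ = refl

if-¬T : {A : Set} {b : Bool} {x y : A} → ¬ T b → (if b then x else y) ≡ y
if-¬T {b = true}  ¬t = ⊥-elim (¬t _)
if-¬T {b = false} _  = refl

module ListSum {c ℓ} (S : Semiring c ℓ) where

  open Semiring S hiding (zero) renaming (refl to ≈-refl)
  open import Relation.Binary.Reasoning.Setoid setoid
  open import Algebra.Properties.Semiring.Sum S using (sum-syntax; sum-replicate-zero)
    renaming (∑-distrib-+ to ∑<-distrib-+)

  private variable A B : Set

  ∑-list : List A → (A → Carrier) → Carrier
  ∑-list xs f = foldr _+_ 0# (map f xs)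

  infixl 10 ∑-list
  syntax ∑-list xs (λ x → e) = ∑[ x ∈ xs ] e

  ∑-cong : (xs : List A) {f g : A → Carrier} → (∀ x → f x ≈ g x) → ∑[ x ∈ xs ] f x ≈ ∑[ x ∈ xs ] g x
  ∑-cong []       f≈g = ≈-refl
  ∑-cong (x ∷ xs) f≈g = +-cong (f≈g x) (∑-cong xs f≈g)

  ∑-zero : (xs : List A) → ∑[ x ∈ xs ] 0# ≈ 0#
  ∑-zero []       = ≈-refl
  ∑-zero (x ∷ xs) = trans (+-identityˡ _) (∑-zero xs)

  ∑-++ : (xs ys : List A) (f : A → Carrier) → ∑[ x ∈ xs ++ ys ] f x ≈ ∑[ x ∈ xs ] f x + ∑[ y ∈ ys ] f y
  ∑-++ []       ys f = sym (+-identityˡ _)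
  ∑-++ (x ∷ xs) ys f = trans (+-congˡ (∑-++ xs ys f)) (sym (+-assoc _ _ _))

  ∑-map : (h : A → B) (xs : List A) (f : B → Carrier) → ∑[ y ∈ map h xs ] f y ≈ ∑[ x ∈ xs ] f (h x)
  ∑-map h []       f = ≈-refl
  ∑-map h (x ∷ xs) f = +-congˡ (∑-map h xs f)

  ∑-concatMap : (h : A → List B) (xs : List A) (f : B → Carrier) →
                ∑[ y ∈ concatMap h xs ] f y ≈ ∑[ x ∈ xs ] ∑[ y ∈ h x ] f y
  ∑-concatMap h []       f = ≈-refl
  ∑-concatMap h (x ∷ xs) f = trans (∑-++ (h x) _ f) (+-congˡ (∑-concatMap h xs f))

  ∑-distrib-+ : (xs : List A) (f g : A → Carrier) → ∑[ x ∈ xs ] (f x + g x) ≈ ∑[ x ∈ xs ] f x + ∑[ x ∈ xs ] g x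
  ∑-distrib-+ []       f g = sym (+-identityˡ 0#)
  ∑-distrib-+ (x ∷ xs) f g = begin
    f x + g x + ∑[ y ∈ xs ] (f y + g y)             ≈⟨ +-congˡ (∑-distrib-+ xs f g) ⟩
    f x + g x + (∑[ y ∈ xs ] f y + ∑[ y ∈ xs ] g y) ≈⟨ +-assoc _ _ _ ⟩
    f x + (g x + (∑[ y ∈ xs ] f y + ∑[ y ∈ xs ] g y)) ≈⟨ +-congˡ (sym (+-assoc _ _ _)) ⟩
    f x + (g x + ∑[ y ∈ xs ] f y + ∑[ y ∈ xs ] g y) ≈⟨ +-congˡ (+-congʳ (+-comm _ _)) ⟩
    f x + (∑[ y ∈ xs ] f y + g x + ∑[ y ∈ xs ] g y) ≈⟨ +-congˡ (+-assoc _ _ _) ⟩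
    f x + (∑[ y ∈ xs ] f y + (g x + ∑[ y ∈ xs ] g y)) ≈⟨ sym (+-assoc _ _ _) ⟩
    f x + ∑[ y ∈ xs ] f y + (g x + ∑[ y ∈ xs ] g y) ∎

  ∑-comm : (xs : List A) (ys : List B) (f : A → B → Carrier) →
           ∑[ x ∈ xs ] ∑[ y ∈ ys ] f x y ≈ ∑[ y ∈ ys ] ∑[ x ∈ xs ] f x y
  ∑-comm []       ys f = sym (∑-zero ys)
  ∑-comm (x ∷ xs) ys f = trans (+-congˡ (∑-comm xs ys f)) (sym (∑-distrib-+ ys (f x) _))

  ∑-comm-Fin : (xs : List A) (n : ℕ) (f : A → Fin n → Carrier) →
               ∑[ x ∈ xs ] ∑[ i < n ] f x i ≈ ∑[ i < n ] ∑[ x ∈ xs ] f x i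
  ∑-comm-Fin []       n f = sym (sum-replicate-zero n)
  ∑-comm-Fin (x ∷ xs) n f = trans (+-congˡ (∑-comm-Fin xs n f)) (sym (∑<-distrib-+ (f x) _))

  *-distribˡ-∑ : (a : Carrier) (xs : List A) (f : A → Carrier) → a * ∑[ x ∈ xs ] f x ≈ ∑[ x ∈ xs ] (a * f x)
  *-distribˡ-∑ a []       f = zeroʳ a
  *-distribˡ-∑ a (x ∷ xs) f = trans (distribˡ a _ _) (+-congˡ (*-distribˡ-∑ a xs f))

  ∑-filter : (p : A → Bool) (xs : List A) (f : A → Carrier) →
             ∑[ x ∈ filter (λ x → p x Bool.≟ true) xs ] f x ≈ ∑[ x ∈ xs ] (if p x then f x else 0#)
  ∑-filter p []       f = ≈-refl
  ∑-filter p (x ∷ xs) f with p x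
  ... | true  = +-congˡ (∑-filter p xs f)
  ... | false = trans (∑-filter p xs f) (sym (+-identityˡ _))

  ∑-allFuns-suc : (L : List A) (n : ℕ) (f : (Fin (suc n) → A) → Carrier) →
                  ∑[ h ∈ allFuns L (suc n) ] f h ≈ ∑[ x ∈ L ] ∑[ h ∈ allFuns L n ] f (x ∷ᶠ h)
  ∑-allFuns-suc L n f = trans (∑-concatMap _ L f) (∑-cong L (λ x → ∑-map (x ∷ᶠ_) (allFuns L n) f))

  ∑-allFuns-zip : {C : Set} (L : List A) (M : List B) (op : A → B → C) (n : ℕ) (φ : (Fin n → C) → Carrier) →
                  (∀ {g h} → g ≗ h → φ g ≈ φ h) →
                  ∑[ g ∈ allFuns (concatMap (λ a → map (op a) M) L) n ] φ g
                    ≈ ∑[ c ∈ allFuns L n ] ∑[ R ∈ allFuns M n ] φ (λ i → op (c i) (R i))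
  ∑-allFuns-zip L M op zero    φ φ-resp = trans (+-congʳ (φ-resp (λ ()))) (sym (+-identityʳ _))
  ∑-allFuns-zip L M op (suc n) φ φ-resp = begin
    ∑[ g ∈ allFuns LM (suc n) ] φ g
      ≈⟨ ∑-allFuns-suc LM n φ ⟩
    ∑[ y ∈ LM ] ∑[ g ∈ allFuns LM n ] φ (y ∷ᶠ g)
      ≈⟨ ∑-concatMap (λ a → map (op a) M) L _ ⟩
    ∑[ a ∈ L ] ∑[ y ∈ map (op a) M ] ∑[ g ∈ allFuns LM n ] φ (y ∷ᶠ g)
      ≈⟨ ∑-cong L (λ a → ∑-map (op a) M _) ⟩
    ∑[ a ∈ L ] ∑[ m ∈ M ] ∑[ g ∈ allFuns LM n ] φ (op a m ∷ᶠ g)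
      ≈⟨ ∑-cong L (λ a → ∑-cong M (λ m → ∑-allFuns-zip L M op n (λ g → φ (op a m ∷ᶠ g))
           (λ g≗h → φ-resp λ { zero → refl ; (suc i) → g≗h i }))) ⟩
    ∑[ a ∈ L ] ∑[ m ∈ M ] ∑[ c ∈ allFuns L n ] ∑[ R ∈ allFuns M n ] φ (op a m ∷ᶠ (λ i → op (c i) (R i)))
      ≈⟨ ∑-cong L (λ a → ∑-comm M (allFuns L n) _) ⟩
    ∑[ a ∈ L ] ∑[ c ∈ allFuns L n ] ∑[ m ∈ M ] ∑[ R ∈ allFuns M n ] φ (op a m ∷ᶠ (λ i → op (c i) (R i)))
      ≈⟨ ∑-cong L (λ a → ∑-cong (allFuns L n) (λ c → ∑-cong M (λ m → ∑-cong (allFuns M n) (λ R →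
           φ-resp λ { zero → refl ; (suc i) → refl })))) ⟩
    ∑[ a ∈ L ] ∑[ c ∈ allFuns L n ] ∑[ m ∈ M ] ∑[ R ∈ allFuns M n ] φ (λ i → op ((a ∷ᶠ c) i) ((m ∷ᶠ R) i))
      ≈⟨ ∑-cong L (λ a → ∑-cong (allFuns L n) (λ c → sym (∑-allFuns-suc M n _))) ⟩
    ∑[ a ∈ L ] ∑[ c ∈ allFuns L n ] ∑[ R ∈ allFuns M (suc n) ] φ (λ i → op ((a ∷ᶠ c) i) (R i))
      ≈⟨ sym (∑-allFuns-suc L n _) ⟩
    ∑[ c ∈ allFuns L (suc n) ] ∑[ R ∈ allFuns M (suc n) ] φ (λ i → op (c i) (R i)) ∎
    where LM = concatMap (λ a → map (op a) M) L

  bools : List Bool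
  bools = true ∷ false ∷ []

  ∑-allFuns-indicator : (n : ℕ) (f : Fin n → Bool) (K : Carrier) →
                        ∑[ r ∈ allFuns bools n ] (if r ≗ᵇ f then K else 0#) ≈ K
  ∑-allFuns-indicator zero    f K = +-identityʳ K
  ∑-allFuns-indicator (suc n) f K = trans (∑-allFuns-suc bools n _) (split (f zero))
    where
    rest≈K = ∑-allFuns-indicator n (f ∘ suc) K
    rest≈0 = ∑-zero (allFuns bools n)
    split : (b : Bool) →
      ∑[ x ∈ bools ] ∑[ r ∈ allFuns bools n ] (if ⌊ x Bool.≟ b ⌋ ∧ (r ≗ᵇ f ∘ suc) then K else 0#) ≈ K
    split true  = trans (+-cong rest≈K (trans (+-identityʳ _) rest≈0)) (+-identityʳ K)
    split false = trans (+-cong rest≈0 (trans (+-identityʳ _) rest≈K)) (+-identityˡ K)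

infix 4 _∼[_]_

_∼[_]_ : {n : ℕ} → Fin n → Rel n → Fin n → Set
i ∼[ R ] j = T (R i j)

Arc : {n : ℕ} → Rel n → Fin n → Fin n → Set
Arc R i j = i Fin.< j × i ∼[ R ] j × (∀ k → i Fin.< k → k Fin.< j → ¬ i ∼[ R ] k)

NoCrossing : {n : ℕ} → Rel n → Set
NoCrossing {n} R = (a b c d : Fin n) → Arc R a c → Arc R b d →
                   a Fin.< b → 2 ℕ.+ toℕ b ℕ.≤ toℕ c → c Fin.< d → ⊥

IsNC2 : {n : ℕ} → Rel n → Set
IsNC2 R = IsEquivalence (_∼[ R ]_) × NoCrossing R

module _ {n : ℕ} {R : Rel n} where

  T-isArc : {i j : Fin n} → T (isArc R i j) ⇔ Arc R i j
  T-isArc = mk⇔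
    (λ t → let (i<j , t′) = to T-∧ t ; (i∼j , t″) = to T-∧ t′ in
      to T-<F i<j , i∼j , λ k i<k k<j i∼k → to T-∄F t″ k (from T-∧ (from T-<F i<k , from T-∧ (from T-<F k<j , i∼k))))
    (λ (i<j , i∼j , gap) → from T-∧ (from T-<F i<j , from T-∧ (i∼j , from T-∄F λ k t →
      let (i<k , t′) = to T-∧ t ; (k<j , i∼k) = to T-∧ t′ in gap k (to T-<F i<k) (to T-<F k<j) i∼k)))

  T-isEquivalence : T (isEquivalence R) ⇔ IsEquivalence (_∼[ R ]_)
  T-isEquivalence = mk⇔
    (λ t → let (r , t′) = to T-∧ t ; (s , tr) = to T-∧ t′ in record
      { refl  = λ {i} → to T-∀F r i
      ; sym   = λ {i} {j} → to T-⇒ (to T-∀F (to T-∀F s i) j)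
      ; trans = λ {i} {j} {k} i∼j j∼k → to T-⇒ (to T-∀F (to T-∀F (to T-∀F tr i) j) k) (from T-∧ (i∼j , j∼k)) })
    (λ e → let module E = IsEquivalence e in from T-∧
      ( from (T-∀F {p = λ i → R i i}) (λ _ → E.refl)
      , from T-∧ ( from T-∀F (λ i → from (T-∀F {p = λ j → R i j ⇒ R j i}) λ _ → from T-⇒ E.sym)
                 , from T-∀F (λ i → from T-∀F λ j → from (T-∀F {p = λ k → (R i j ∧ R j k) ⇒ R i k}) λ _ →
                     from T-⇒ λ t → let (i∼j , j∼k) = to T-∧ t in E.trans i∼j j∼k))))

  T-is2DistantNoncrossing : T (is2DistantNoncrossing R) ⇔ NoCrossing R
  T-is2DistantNoncrossing = mk⇔
    (λ t a b c d ac bd a<b b+2≤c c<d → to T-∄F t a (from T-∃F (b , from T-∃F (c , from T-∃F (d ,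
      from T-∧ (from T-isArc ac , from T-∧ (from T-isArc bd , from T-∧ (from T-<F a<b , from T-∧
        (ℕP.≤⇒≤ᵇ (ℕP.m+n≤o⇒n≤o 2 b+2≤c) , from T-∧ (from T-<F c<d , ℕP.≤⇒≤ᵇ (ℕP.m+n≤o⇒m≤o∸n 2 b+2≤c)))))))))))
    (λ nc → from T-∄F λ a t →
      let (b , t) = to T-∃F t ; (c , t) = to T-∃F t ; (d , t) = to T-∃F t
          (ac , t) = to T-∧ t ; (bd , t) = to T-∧ t ; (a<b , t) = to T-∧ t
          (b≤c , t) = to T-∧ t ; (c<d , 2≤c∸b) = to T-∧ t
      in nc a b c d (to T-isArc ac) (to T-isArc bd) (to T-<F a<b)
            (ℕP.m≤o∸n⇒m+n≤o 2 (ℕP.≤ᵇ⇒≤ _ _ b≤c) (ℕP.≤ᵇ⇒≤ 2 _ 2≤c∸b)) (to T-<F c<d))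

  T-isNC2 : T (isNC2 R) ⇔ IsNC2 R
  T-isNC2 = mk⇔ (λ t → let (e , nc) = to T-∧ t in to T-isEquivalence e , to T-is2DistantNoncrossing nc)
                (λ (e , nc) → from T-∧ (from T-isEquivalence e , from T-is2DistantNoncrossing nc))

isBlockMin : {n : ℕ} → Rel n → Fin n → Bool
isBlockMin {n} R m = not (∃F n λ i → (i <F m) ∧ R i m)

isUncovered : {n : ℕ} → Rel n → Fin n → Bool
isUncovered {n} R m = not (∃F n λ b → ∃F n λ d → isArc R b d ∧ (2 ℕ.+ toℕ b ℕ.≤ᵇ toℕ m) ∧ (m <F d))

isActive : {n : ℕ} → Rel n → Fin n → Bool
isActive R m = isBlockMin R m ∧ isUncovered R m

IsBlockMin : {n : ℕ} → Rel n → Fin n → Set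
IsBlockMin R m = ∀ i → i Fin.< m → ¬ i ∼[ R ] m

Uncovered : {n : ℕ} → Rel n → Fin n → Set
Uncovered R m = ∀ b d → Arc R b d → 2 ℕ.+ toℕ b ℕ.≤ toℕ m → m Fin.< d → ⊥

Active : {n : ℕ} → Rel n → Fin n → Set
Active R m = IsBlockMin R m × Uncovered R m

module _ {n : ℕ} {R : Rel n} {m : Fin n} where

  T-isBlockMin : T (isBlockMin R m) ⇔ IsBlockMin R m
  T-isBlockMin = mk⇔ (λ t i i<m i∼m → to T-∄F t i (from T-∧ (from T-<F i<m , i∼m)))
                     (λ min → from T-∄F λ i t → let (i<m , i∼m) = to T-∧ t in min i (to T-<F i<m) i∼m)

  T-isUncovered : T (isUncovered R m) ⇔ Uncovered R m
  T-isUncovered = mk⇔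
    (λ t b d bd b+2≤m m<d → to T-∄F t b (from T-∃F (d ,
      from T-∧ (from (T-isArc {R = R}) bd , from T-∧ (ℕP.≤⇒≤ᵇ b+2≤m , from T-<F m<d)))))
    (λ unc → from T-∄F λ b t → let (d , t) = to T-∃F t ; (bd , t) = to T-∧ t ; (b+2≤m , m<d) = to T-∧ t in
      unc b d (to (T-isArc {R = R}) bd) (ℕP.≤ᵇ⇒≤ (2 ℕ.+ toℕ b) (toℕ m) b+2≤m) (to T-<F m<d))

  T-isActive : T (isActive R m) ⇔ Active R m
  T-isActive = mk⇔ (λ t → let (min , unc) = to T-∧ t in to T-isBlockMin min , to T-isUncovered unc)
                   (λ (min , unc) → from T-∧ (from T-isBlockMin min , from T-isUncovered unc))

blockMin-unique : {n : ℕ} {R : Rel n} → IsEquivalence (_∼[ R ]_) → {m m′ : Fin n} →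
                  IsBlockMin R m → IsBlockMin R m′ → m ∼[ R ] m′ → m ≡ m′
blockMin-unique e {m} {m′} min min′ m∼m′ with ℕP.<-cmp (toℕ m) (toℕ m′)
... | tri< m<m′ _ _ = ⊥-elim (min′ m m<m′ m∼m′)
... | tri≈ _ m≡m′ _ = FinP.toℕ-injective m≡m′
... | tri> _ _ m′<m = ⊥-elim (min m′ m′<m (IsEquivalence.sym e m∼m′))

infix 4 _≐_

_≐_ : {n : ℕ} → Rel n → Rel n → Set
R ≐ S = ∀ i j → R i j ≡ S i j

module _ {n : ℕ} {R S : Rel n} (R≐S : R ≐ S) where

  isArc-cong : ∀ i j → isArc R i j ≡ isArc S i j
  isArc-cong i j = ≡.cong₂ (λ a b → (i <F j) ∧ a ∧ not b) (R≐S i j)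
    (∃F-cong n λ k → ≡.cong (λ a → (i <F k) ∧ (k <F j) ∧ a) (R≐S i k))

  isNC2-cong : isNC2 R ≡ isNC2 S
  isNC2-cong = ≡.cong₂ _∧_
    (≡.cong₂ _∧_ (∀F-cong n λ i → R≐S i i) (≡.cong₂ _∧_
      (∀F-cong n λ i → ∀F-cong n λ j → ≡.cong₂ _⇒_ (R≐S i j) (R≐S j i))
      (∀F-cong n λ i → ∀F-cong n λ j → ∀F-cong n λ k → ≡.cong₂ _⇒_ (≡.cong₂ _∧_ (R≐S i j) (R≐S j k)) (R≐S i k))))
    (≡.cong not (∃F-cong n λ a → ∃F-cong n λ b → ∃F-cong n λ c → ∃F-cong n λ d →
      ≡.cong₂ (λ u v → u ∧ v ∧ _) (isArc-cong a c) (isArc-cong b d)))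

  isActive-cong : ∀ m → isActive R m ≡ isActive S m
  isActive-cong m = ≡.cong₂ _∧_
    (≡.cong not (∃F-cong n λ i → ≡.cong ((i <F m) ∧_) (R≐S i m)))
    (≡.cong not (∃F-cong n λ b → ∃F-cong n λ d → ≡.cong (_∧ _) (isArc-cong b d)))

-- Prepending a new least element

∅ : {n : ℕ} → Fin n → Bool
∅ _ = false

extend : {n : ℕ} → Bool → (Fin n → Bool) → (Fin n → Bool) → Rel n → Rel (suc n)
extend x r c R = (x ∷ᶠ r) ∷ᶠ (λ i → c i ∷ᶠ R i)

extend-cong : {n : ℕ} {R : Rel n} {r s : Fin n → Bool} → r ≗ s → extend true r r R ≐ extend true s s R
extend-cong r≗s zero    zero    = refl
extend-cong r≗s zero    (suc j) = r≗s j
extend-cong r≗s (suc i) zero    = r≗s i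
extend-cong r≗s (suc i) (suc j) = refl

IsLeast : {n : ℕ} → (Fin n → Bool) → Fin n → Set
IsLeast r m = T (r m) × (∀ k → k Fin.< m → ¬ T (r k))

least : {n : ℕ} (r : Fin n → Bool) {i : Fin n} → T (r i) → ∃[ m ] IsLeast r m
least {suc n} r {i} ri with r zero in r₀≡
least r {i}     ri | true  = zero , from T-≡ r₀≡ , λ _ ()
least r {zero}  ri | false = ⊥-elim (≡.subst T r₀≡ ri)
least r {suc i} ri | false = let (m , rm , below) = least (r ∘ suc) ri in
  suc m , rm , λ { zero _ r₀ → ≡.subst T r₀≡ r₀ ; (suc k) (s≤s k<m) → below k k<m }

UncoveredByNewArc : {n : ℕ} → (Fin n → Bool) → Fin n → Set
UncoveredByNewArc r m = ∀ m₀ → IsLeast r m₀ → 1 ℕ.≤ toℕ m → m Fin.< m₀ → ⊥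

module _ {n : ℕ} {x : Bool} {r c : Fin n → Bool} {R : Rel n} where

  private
    E = extend x r c R

  Arc-extend : {i j : Fin n} → Arc E (suc i) (suc j) ⇔ Arc R i j
  Arc-extend = mk⇔ (λ { (s≤s i<j , i∼j , gap) → i<j , i∼j , λ k i<k k<j → gap (suc k) (s≤s i<k) (s≤s k<j) })
                   (λ { (i<j , i∼j , gap) → s≤s i<j , i∼j ,
                          λ { zero () ; (suc k) (s≤s i<k) (s≤s k<j) → gap k i<k k<j } })

  Arc-extend-zero : {j : Fin n} → Arc E zero (suc j) ⇔ IsLeast r j
  Arc-extend-zero = mk⇔ (λ (_ , rj , gap) → rj , λ k k<j → gap (suc k) (s≤s z≤n) (s≤s k<j))
                        (λ (rj , below) → s≤s z≤n , rj , λ { zero () ; (suc k) _ (s≤s k<j) → below k k<j })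

  ¬Arc-to-zero : {i : Fin (suc n)} → ¬ Arc E i zero
  ¬Arc-to-zero (() , _)

  isEquivalence-restrict : IsEquivalence (_∼[ E ]_) → IsEquivalence (_∼[ R ]_)
  isEquivalence-restrict e = record
    { refl  = λ {i} → E.refl {suc i}
    ; sym   = λ {i} {j} → E.sym {suc i} {suc j}
    ; trans = λ {i} {j} {k} → E.trans {suc i} {suc j} {suc k}
    }
    where module E = IsEquivalence e

  extend-sym : IsEquivalence (_∼[ E ]_) → c ≗ r
  extend-sym e i = T-injective (mk⇔ (E.sym {suc i} {zero}) (E.sym {zero} {suc i}))
    where module E = IsEquivalence e

  noCrossing-extend⁻ : NoCrossing E → NoCrossing R × (∀ m → IsLeast r m → Uncovered R m)
  noCrossing-extend⁻ nc =
    (λ a b c′ d ac bd a<b b+2≤c c<d →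
      nc (suc a) (suc b) (suc c′) (suc d) (from Arc-extend ac) (from Arc-extend bd) (s≤s a<b) (s≤s b+2≤c) (s≤s c<d)) ,
    (λ m least-m b d bd b+2≤m m<d →
      nc zero (suc b) (suc m) (suc d) (from Arc-extend-zero least-m) (from Arc-extend bd)
         (s≤s z≤n) (s≤s b+2≤m) (s≤s m<d))

  noCrossing-extend⁺ : NoCrossing R → (∀ m → IsLeast r m → Uncovered R m) → NoCrossing E
  noCrossing-extend⁺ nc unc a       b       zero     d       ac = ⊥-elim (¬Arc-to-zero ac)
  noCrossing-extend⁺ nc unc a       zero    (suc c′) d       ac bd ()
  noCrossing-extend⁺ nc unc a       (suc b) (suc c′) zero    ac bd a<b b+2≤c ()
  noCrossing-extend⁺ nc unc zero    (suc b) (suc c′) (suc d) ac bd a<b (s≤s b+2≤c) (s≤s c<d) =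
    unc c′ (to Arc-extend-zero ac) b d (to Arc-extend bd) b+2≤c c<d
  noCrossing-extend⁺ nc unc (suc a) (suc b) (suc c′) (suc d) ac bd (s≤s a<b) (s≤s b+2≤c) (s≤s c<d) =
    nc a b c′ d (to Arc-extend ac) (to Arc-extend bd) a<b b+2≤c c<d

  isBlockMin-extend : {m : Fin n} → IsBlockMin E (suc m) ⇔ (¬ T (r m) × IsBlockMin R m)
  isBlockMin-extend = mk⇔ (λ min → min zero (s≤s z≤n) , λ i i<m → min (suc i) (s≤s i<m))
                          (λ { (¬rm , min) zero _ → ¬rm ; (¬rm , min) (suc i) (s≤s i<m) → min i i<m })

  uncovered-extend : {m : Fin n} → Uncovered E (suc m) ⇔ (Uncovered R m × UncoveredByNewArc r m)
  uncovered-extend {m} = mk⇔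
    (λ unc → (λ b d bd b+2≤m m<d → unc (suc b) (suc d) (from Arc-extend bd) (s≤s b+2≤m) (s≤s m<d)) ,
             (λ m₀ least-m₀ 1≤m m<m₀ → unc zero (suc m₀) (from Arc-extend-zero least-m₀) (s≤s 1≤m) (s≤s m<m₀)))
    (λ (unc , out) → uncovered⁺ unc out)
    where
    uncovered⁺ : Uncovered R m → UncoveredByNewArc r m → Uncovered E (suc m)
    uncovered⁺ unc out b       zero    bd = ⊥-elim (¬Arc-to-zero bd)
    uncovered⁺ unc out zero    (suc d) bd (s≤s 1≤m) (s≤s m<d) = out d (to Arc-extend-zero bd) 1≤m m<d
    uncovered⁺ unc out (suc b) (suc d) bd (s≤s b+2≤m) (s≤s m<d) = unc b d (to Arc-extend bd) b+2≤m m<d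

  isNC2-restrict : IsNC2 E → IsNC2 R
  isNC2-restrict (e , nc) = isEquivalence-restrict e , proj₁ (noCrossing-extend⁻ nc)

zero-active : {n : ℕ} {R : Rel (suc n)} → Active R zero
zero-active = (λ _ ()) , (λ { _ _ _ () _ })

isActive-extend-∅ : {n : ℕ} {R : Rel n} {m : Fin n} → isActive (extend true ∅ ∅ R) (suc m) ≡ isActive R m
isActive-extend-∅ {R = R} = T-injective (mk⇔
  (λ t → let (min , unc) = to T-isActive t in
    from T-isActive (proj₂ (to isBlockMin-extend min) , proj₁ (to (uncovered-extend {r = ∅} {R = R}) unc)))
  (λ t → let (min , unc) = to T-isActive t in
    from T-isActive (from isBlockMin-extend ((λ ()) , min) ,
                     from (uncovered-extend {r = ∅} {R = R}) (unc , λ { _ (() , _) }))))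

BlockOrEmpty : {n : ℕ} → Rel n → (Fin n → Bool) → Set
BlockOrEmpty R r = (∀ {i j} → T (r i) → T (r j) → i ∼[ R ] j) × (∀ {i j} → T (r i) → i ∼[ R ] j → T (r j))

module _ {n : ℕ} {r : Fin n → Bool} {R : Rel n} where

  private
    E = extend true r r R

  isEquivalence-extend⁻ : IsEquivalence (_∼[ E ]_) → BlockOrEmpty R r
  isEquivalence-extend⁻ e = (λ {i} {j} → E.trans {suc i} {zero} {suc j}) , (λ {i} {j} → E.trans {zero} {suc i} {suc j})
    where module E = IsEquivalence e

  isEquivalence-extend⁺ : IsEquivalence (_∼[ R ]_) → BlockOrEmpty R r → IsEquivalence (_∼[ E ]_)
  isEquivalence-extend⁺ e (together , closed) = record
    { refl = λ {i} → refl′ i ; sym = λ {i} {j} → sym′ i j ; trans = λ {i} {j} {k} → trans′ i j k }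
    where
    module Eq = IsEquivalence e
    refl′ : ∀ i → i ∼[ E ] i
    refl′ zero    = _
    refl′ (suc i) = Eq.refl
    sym′ : ∀ i j → i ∼[ E ] j → j ∼[ E ] i
    sym′ zero    zero    t = t
    sym′ zero    (suc j) t = t
    sym′ (suc i) zero    t = t
    sym′ (suc i) (suc j) t = Eq.sym t
    trans′ : ∀ i j k → i ∼[ E ] j → j ∼[ E ] k → i ∼[ E ] k
    trans′ zero    zero    k       _   j∼k = j∼k
    trans′ zero    (suc j) zero    _   _   = _
    trans′ zero    (suc j) (suc k) i∼j j∼k = closed i∼j j∼k
    trans′ (suc i) zero    zero    i∼j _   = i∼j
    trans′ (suc i) zero    (suc k) i∼j j∼k = together i∼j j∼k
    trans′ (suc i) (suc j) zero    i∼j j∼k = closed j∼k (Eq.sym i∼j)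
    trans′ (suc i) (suc j) (suc k) i∼j j∼k = Eq.trans i∼j j∼k

module _ {n : ℕ} {R : Rel n} (e : IsEquivalence (_∼[ R ]_)) {m₀ : Fin n} (min₀ : IsBlockMin R m₀) where

  private
    module Eq = IsEquivalence e

  blockMin-least : IsLeast (R m₀) m₀
  blockMin-least = Eq.refl , λ k k<m₀ m₀∼k → min₀ k k<m₀ (Eq.sym m₀∼k)

  least-unique : {m : Fin n} → IsLeast (R m₀) m → m ≡ m₀
  least-unique {m} (m₀∼m , below) with ℕP.<-cmp (toℕ m) (toℕ m₀)
  ... | tri< m<m₀ _ _ = ⊥-elim (min₀ m m<m₀ (Eq.sym m₀∼m))
  ... | tri≈ _ m≡m₀ _ = FinP.toℕ-injective m≡m₀
  ... | tri> _ _ m₀<m = ⊥-elim (below m₀ m₀<m Eq.refl)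

  active-extend-block : {m : Fin n} →
    Active (extend true (R m₀) (R m₀) R) (suc m) ⇔ (Active R m × m ≢ m₀ × (toℕ m ≡ 0 ⊎ m₀ Fin.< m))
  active-extend-block {m} = mk⇔ to′ from′
    where
    to′ : Active (extend true (R m₀) (R m₀) R) (suc m) → Active R m × m ≢ m₀ × (toℕ m ≡ 0 ⊎ m₀ Fin.< m)
    to′ (min′ , unc′) = (min , unc) , m≢m₀ , position
      where
      ¬m₀∼m = proj₁ (to isBlockMin-extend min′)
      min = proj₂ (to isBlockMin-extend min′)
      unc = proj₁ (to uncovered-extend unc′)
      out = proj₂ (to uncovered-extend unc′)
      m≢m₀ : m ≢ m₀
      m≢m₀ m≡m₀ = ¬m₀∼m (≡.subst (m₀ ∼[ R ]_) (≡.sym m≡m₀) Eq.refl)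
      position : toℕ m ≡ 0 ⊎ m₀ Fin.< m
      position with toℕ m ℕ.≟ 0 | ℕP.<-cmp (toℕ m₀) (toℕ m)
      ... | yes m≡0 | _              = inj₁ m≡0
      ... | no  _   | tri< m₀<m _ _ = inj₂ m₀<m
      ... | no  _   | tri≈ _ m₀≡m _ = ⊥-elim (m≢m₀ (FinP.toℕ-injective (≡.sym m₀≡m)))
      ... | no  m≢0 | tri> _ _ m<m₀ = ⊥-elim (out m₀ blockMin-least (ℕP.n≢0⇒n>0 m≢0) m<m₀)
    from′ : Active R m × m ≢ m₀ × (toℕ m ≡ 0 ⊎ m₀ Fin.< m) → Active (extend true (R m₀) (R m₀) R) (suc m)
    from′ ((min , unc) , m≢m₀ , position) =
      from isBlockMin-extend ((λ m₀∼m → m≢m₀ (≡.sym (blockMin-unique e min₀ min m₀∼m))) , min) ,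
      from uncovered-extend (unc , out)
      where
      out : UncoveredByNewArc (R m₀) m
      out m₀′ least-m₀′ 1≤m m<m₀′ = Sum.[ (λ m≡0 → ℕP.<-irrefl (≡.sym m≡0) 1≤m)
                                             , ℕP.<-asym (≡.subst (m Fin.<_) (least-unique least-m₀′) m<m₀′) ] position

staysActive : {n : ℕ} → Fin n → Fin n → Bool
staysActive m₀ m = not (toℕ m ℕ.≡ᵇ toℕ m₀) ∧ ((toℕ m ℕ.≡ᵇ 0) ∨ (toℕ m₀ ℕ.<ᵇ toℕ m))

T-staysActive : {n : ℕ} {m₀ m : Fin n} → T (staysActive m₀ m) ⇔ (m ≢ m₀ × (toℕ m ≡ 0 ⊎ m₀ Fin.< m))
T-staysActive {m₀ = m₀} {m} = mk⇔
  (λ t → let (ne , pos) = to T-∧ t in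
    (λ m≡m₀ → to T-not ne (ℕP.≡⇒≡ᵇ _ _ (≡.cong toℕ m≡m₀))) ,
    Sum.map (ℕP.≡ᵇ⇒≡ (toℕ m) 0) (ℕP.<ᵇ⇒< (toℕ m₀) (toℕ m)) (to T-∨ pos))
  (λ (m≢m₀ , pos) → from T-∧
    ( from T-not (λ t → m≢m₀ (FinP.toℕ-injective (ℕP.≡ᵇ⇒≡ (toℕ m) (toℕ m₀) t)))
    , from T-∨ (Sum.map (ℕP.≡⇒≡ᵇ (toℕ m) 0) ℕP.<⇒<ᵇ pos)))

isActive-extend-block : {n : ℕ} {R : Rel n} → IsEquivalence (_∼[ R ]_) → {m₀ m : Fin n} → IsBlockMin R m₀ →
                        isActive (extend true (R m₀) (R m₀) R) (suc m) ≡ isActive R m ∧ staysActive m₀ m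
isActive-extend-block e min₀ = T-injective (mk⇔
  (λ t → let (act , stays) = to (active-extend-block e min₀) (to T-isActive t) in
    from T-∧ (from T-isActive act , from T-staysActive stays))
  (λ t → let (act , stays) = to T-∧ t in
    from T-isActive (from (active-extend-block e min₀) (to T-isActive act , to T-staysActive stays))))

module _ {n : ℕ} {R : Rel n} where

  isNC2-extend-∅ : IsNC2 R → IsNC2 (extend true ∅ ∅ R)
  isNC2-extend-∅ (e , nc) = isEquivalence-extend⁺ e ((λ ()) , (λ ())) , noCrossing-extend⁺ nc (λ { _ (() , _) })

  isNC2-extend-block : IsNC2 R → {m₀ : Fin n} → Active R m₀ → IsNC2 (extend true (R m₀) (R m₀) R)
  isNC2-extend-block (e , nc) {m₀} (min₀ , unc₀) =
    isEquivalence-extend⁺ e ((λ m₀∼i m₀∼j → Eq.trans (Eq.sym m₀∼i) m₀∼j) , Eq.trans) ,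
    noCrossing-extend⁺ nc (λ m least-m → ≡.subst (Uncovered R) (≡.sym (least-unique e min₀ least-m)) unc₀)
    where module Eq = IsEquivalence e

  isNC2-extend⁻ : {r : Fin n → Bool} → IsNC2 (extend true r r R) →
                  (∀ i → ¬ T (r i)) ⊎ ∃[ m₀ ] (Active R m₀ × r ≗ R m₀)
  isNC2-extend⁻ {r} (e , nc) with ∃F n r in r≢∅
  ... | false = inj₁ λ i ri → ≡.subst T r≢∅ (from T-∃F (i , ri))
  ... | true  = let (_ , ri) = to (T-∃F {p = r}) (from T-≡ r≢∅) ; (m₀ , least-m₀@(rm₀ , below)) = least r ri in
    inj₂ (m₀ , ( (λ i i<m₀ i∼m₀ → below i i<m₀ (closed rm₀ (Eq.sym i∼m₀)))
               , proj₂ (noCrossing-extend⁻ nc) m₀ least-m₀) ,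
          λ j → T-injective (mk⇔ (together rm₀) (closed rm₀)))
    where
    module Eq = IsEquivalence (isEquivalence-restrict e)
    together = proj₁ (isEquivalence-extend⁻ e)
    closed = proj₂ (isEquivalence-extend⁻ e)

-- Counting by active elements

module Counting where

  open import Data.Nat using (_+_; _*_)
  open import Data.Nat.Combinatorics using (_C_; nC1≡n; nCk+nC[k+1]≡[n+1]C[k+1])
  open ListSum ℕP.+-*-semiring
  open import Algebra.Properties.Semiring.Sum ℕP.+-*-semiring
    using (sum-syntax; sum-cong-≗; sum-replicate-zero)
  open ≡.≡-Reasoning

  count : {n : ℕ} → (Fin n → Bool) → ℕ
  count {n} a = ∑[ i < n ] (if a i then 1 else 0)

  activeCount : {n : ℕ} → Rel n → ℕ
  activeCount R = count (isActive R)

  weight : {n : ℕ} → (ℕ → ℕ) → Rel n → ℕ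
  weight g R = if isNC2 R then g (activeCount R) else 0

  weightedCount : ℕ → (ℕ → ℕ) → ℕ
  weightedCount n g = ∑[ R ∈ allRels n ] weight g R

  ∑<-zero : {n : ℕ} {f : Fin n → ℕ} → (∀ i → f i ≡ 0) → ∑[ i < n ] f i ≡ 0
  ∑<-zero {n} f≡0 = ≡.trans (sum-cong-≗ f≡0) (sum-replicate-zero n)

  ∑<-single : {n : ℕ} (f : Fin n → ℕ) (m : Fin n) → (∀ i → i ≢ m → f i ≡ 0) → ∑[ i < n ] f i ≡ f m
  ∑<-single f zero    f≡0 = ≡.trans (≡.cong (f zero +_) (∑<-zero λ i → f≡0 (suc i) λ ())) (ℕP.+-identityʳ (f zero))
  ∑<-single f (suc m) f≡0 =
    ≡.cong₂ _+_ (f≡0 zero λ ()) (∑<-single (f ∘ suc) m λ i i≢m → f≡0 (suc i) (i≢m ∘ FinP.suc-injective))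

  length≡∑1 : {A : Set} (xs : List A) → length xs ≡ ∑[ x ∈ xs ] 1
  length≡∑1 []       = refl
  length≡∑1 (x ∷ xs) = ≡.cong suc (length≡∑1 xs)

  numNC2≡weightedCount : (n : ℕ) → numNC2 n ≡ weightedCount n (λ _ → 1)
  numNC2≡weightedCount n = ≡.trans (length≡∑1 (filter (λ R → isNC2 R Bool.≟ true) (allRels n)))
                                   (∑-filter isNC2 (allRels n) (λ _ → 1))

  activeCount-cong : {n : ℕ} {R S : Rel n} → R ≐ S → activeCount R ≡ activeCount S
  activeCount-cong R≐S = sum-cong-≗ λ m → ≡.cong (λ b → if b then 1 else 0) (isActive-cong R≐S m)

  weight-cong : {n : ℕ} (g : ℕ → ℕ) {R S : Rel n} → R ≐ S → weight g R ≡ weight g S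
  weight-cong g R≐S = ≡.cong₂ (λ b k → if b then g k else 0) (isNC2-cong R≐S) (activeCount-cong R≐S)

  joinCount : {n : ℕ} → (Fin n → Bool) → Fin n → ℕ
  joinCount a m₀ = suc (count λ m → a m ∧ staysActive m₀ m)

  activeCount-extend : {n : ℕ} {x : Bool} {r c : Fin n → Bool} {R : Rel n} →
                       activeCount (extend x r c R) ≡ suc (count λ m → isActive (extend x r c R) (suc m))
  activeCount-extend {x = x} {r} {c} {R} =
    ≡.cong (λ b → (if b then 1 else 0) + count λ m → isActive (extend x r c R) (suc m))
    (to T-≡ (from T-isActive (zero-active {R = extend x r c R})))

  activeCount-extend-∅ : {n : ℕ} {R : Rel n} → activeCount (extend true ∅ ∅ R) ≡ suc (activeCount R)
  activeCount-extend-∅ {R = R} = ≡.trans (activeCount-extend {x = true} {∅} {∅} {R})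
    (≡.cong suc (sum-cong-≗ λ m → ≡.cong (λ b → if b then 1 else 0) (isActive-extend-∅ {R = R} {m})))

  activeCount-extend-block : {n : ℕ} {R : Rel n} → IsEquivalence (_∼[ R ]_) → {m₀ : Fin n} → IsBlockMin R m₀ →
                             activeCount (extend true (R m₀) (R m₀) R) ≡ joinCount (isActive R) m₀
  activeCount-extend-block {R = R} e {m₀} min₀ = ≡.trans (activeCount-extend {x = true} {R m₀} {R m₀} {R})
    (≡.cong suc (sum-cong-≗ λ m → ≡.cong (λ b → if b then 1 else 0) (isActive-extend-block e {m = m} min₀)))

  -- From c active elements a new least element leads to c + 1 (new singleton), c (joining the block
  -- of 0) or 2, …, c (joining a later active element); sum₂ g c = g 2 + ⋯ + g (c + 1).
  sum₂ : (ℕ → ℕ) → ℕ → ℕ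
  sum₂ g zero    = 0
  sum₂ g (suc c) = g (2 + c) + sum₂ g c

  transfer : (ℕ → ℕ) → ℕ → ℕ
  transfer g zero    = g 1
  transfer g (suc c) = g (2 + c) + (g (1 + c) + sum₂ g c)

  count-∧-true : {n : ℕ} (a : Fin n → Bool) → count (λ m → a m ∧ true) ≡ count a
  count-∧-true a = sum-cong-≗ λ m → ≡.cong (λ b → if b then 1 else 0) (BoolP.∧-identityʳ (a m))

  ∑-rank : {n : ℕ} (g : ℕ → ℕ) (a : Fin n → Bool) →
           ∑[ m < n ] (if a m then g (2 + count λ m′ → a m′ ∧ (toℕ m ℕ.<ᵇ toℕ m′)) else 0) ≡ sum₂ g (count a)
  ∑-rank {zero}  g a = refl
  ∑-rank {suc n} g a with a zero
  ... | true  = ≡.cong₂ _+_ (≡.cong (λ c → g (2 + c)) (count-∧-true (a ∘ suc))) (∑-rank g (a ∘ suc))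
  ... | false = ∑-rank g (a ∘ suc)

  joinCount-zero : {n : ℕ} (a : Fin (suc n) → Bool) → a zero ≡ true → joinCount a zero ≡ count a
  joinCount-zero a a₀ rewrite a₀ = ≡.cong suc (count-∧-true (a ∘ suc))

  joinCount-suc : {n : ℕ} (a : Fin (suc n) → Bool) → a zero ≡ true → (m₀ : Fin n) →
                  joinCount a (suc m₀) ≡ 2 + count λ m → a (suc m) ∧ (toℕ m₀ ℕ.<ᵇ toℕ m)
  joinCount-suc a a₀ m₀ rewrite a₀ = ≡.cong (2 +_) (sum-cong-≗ λ m →
    ≡.cong (λ b → if b then 1 else 0) (≡.cong (a (suc m) ∧_) (above⇒distinct (toℕ m₀) (toℕ m))))
    where
    above⇒distinct : ∀ x y → not (y ℕ.≡ᵇ x) ∧ (x ℕ.<ᵇ y) ≡ (x ℕ.<ᵇ y)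
    above⇒distinct x y with x ℕ.<ᵇ y in x<y
    ... | false = BoolP.∧-zeroʳ _
    ... | true  = ≡.cong (λ b → not b ∧ true) (to BoolP.T-not-≡ (from T-not λ y≡x →
                    ℕP.<-irrefl (≡.sym (ℕP.≡ᵇ⇒≡ y x y≡x)) (ℕP.<ᵇ⇒< x y (from T-≡ x<y))))

  ∑-joinCount : {n : ℕ} (g : ℕ → ℕ) (a : Fin (suc n) → Bool) → a zero ≡ true →
                g (suc (count a)) + ∑[ m < suc n ] (if a m then g (joinCount a m) else 0) ≡ transfer g (count a)
  ∑-joinCount {n} g a a₀ = begin
    g (suc (count a)) + ((if a zero then g (joinCount a zero) else 0) + ∑[ m < n ] joined (suc m))
      ≡⟨ ≡.cong₂ (λ u v → g (suc u) + v) count-a (≡.cong₂ _+_ first rest) ⟩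
    transfer g (suc c)
      ≡⟨ ≡.cong (transfer g) (≡.sym count-a) ⟩
    transfer g (count a) ∎
    where
    c = count (a ∘ suc)
    joined : Fin (suc n) → ℕ
    joined m = if a m then g (joinCount a m) else 0
    count-a : count a ≡ suc c
    count-a = ≡.cong (λ b → (if b then 1 else 0) + c) a₀
    first : (if a zero then g (joinCount a zero) else 0) ≡ g (suc c)
    first = ≡.trans (if-T (from T-≡ a₀)) (≡.cong g (≡.trans (joinCount-zero a a₀) count-a))
    rest : ∑[ m < n ] joined (suc m) ≡ sum₂ g c
    rest = ≡.trans (sum-cong-≗ λ m → ≡.cong (λ k → if a (suc m) then g k else 0) (joinCount-suc a a₀ m))
                   (∑-rank g (a ∘ suc))

  ∑-activeJoin : {n : ℕ} (g : ℕ → ℕ) (R : Rel n) →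
                 g (suc (activeCount R)) + ∑[ m < n ] (if isActive R m then g (joinCount (isActive R) m) else 0)
                   ≡ transfer g (activeCount R)
  ∑-activeJoin {zero}  g R = ℕP.+-identityʳ (g 1)
  ∑-activeJoin {suc n} g R = ∑-joinCount g (isActive R) (to T-≡ (from T-isActive (zero-active {R = R})))

  module _ {n : ℕ} (g : ℕ → ℕ) {R : Rel n} (nc2 : IsNC2 R) where

    private
      module Eq = IsEquivalence (proj₁ nc2)

    newBlockTerm : (Fin n → Bool) → ℕ
    newBlockTerm r = if r ≗ᵇ ∅ then g (suc (activeCount R)) else 0

    joinTerm : (Fin n → Bool) → Fin n → ℕ
    joinTerm r m = if isActive R m ∧ (r ≗ᵇ R m) then g (joinCount (isActive R) m) else 0

    rejected-terms : (r : Fin n → Bool) → ¬ IsNC2 (extend true r r R) → newBlockTerm r + ∑[ m < n ] joinTerm r m ≡ 0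
    rejected-terms r ¬nc2 = ≡.cong₂ _+_ (if-¬T ¬empty) (∑<-zero λ m → if-¬T (¬block m))
      where
      ¬isNC2-extend : ∀ {s} → r ≗ s → ¬ IsNC2 (extend true s s R)
      ¬isNC2-extend {s} r≗s nc2′ = ¬nc2 (to T-isNC2
        (≡.subst T (≡.sym (isNC2-cong (extend-cong r≗s))) (from (T-isNC2 {R = extend true s s R}) nc2′)))
      ¬empty : ¬ T (r ≗ᵇ ∅)
      ¬empty t = ¬isNC2-extend (to T-≗ᵇ t) (isNC2-extend-∅ nc2)
      ¬block : ∀ m → ¬ T (isActive R m ∧ (r ≗ᵇ R m))
      ¬block m t = let (act , r≗) = to T-∧ t in ¬isNC2-extend (to T-≗ᵇ r≗) (isNC2-extend-block nc2 (to T-isActive act))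

    weight-extend-∅ : (r : Fin n → Bool) → (∀ i → ¬ T (r i)) →
                      g (activeCount (extend true r r R)) ≡ newBlockTerm r + ∑[ m < n ] joinTerm r m
    weight-extend-∅ r empty = begin
      g (activeCount (extend true r r R))
        ≡⟨ ≡.cong g (≡.trans (activeCount-cong (extend-cong r≗∅)) (activeCount-extend-∅ {R = R})) ⟩
      g (suc (activeCount R))
        ≡⟨ ≡.sym (ℕP.+-identityʳ _) ⟩
      g (suc (activeCount R)) + 0
        ≡⟨ ≡.sym (≡.cong₂ _+_ (if-T (from T-≗ᵇ r≗∅)) (∑<-zero λ m → if-¬T (¬block m))) ⟩
      newBlockTerm r + ∑[ m < n ] joinTerm r m ∎
      where
      r≗∅ : r ≗ ∅
      r≗∅ i = to BoolP.T-not-≡ (from T-not (empty i))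
      ¬block : ∀ m → ¬ T (isActive R m ∧ (r ≗ᵇ R m))
      ¬block m t = empty m (≡.subst T (≡.sym (to T-≗ᵇ (proj₂ (to T-∧ t)) m)) Eq.refl)

    weight-extend-block : (r : Fin n → Bool) {m₀ : Fin n} → Active R m₀ → r ≗ R m₀ →
                          g (activeCount (extend true r r R)) ≡ newBlockTerm r + ∑[ m < n ] joinTerm r m
    weight-extend-block r {m₀} act₀@(min₀ , _) r≗ = begin
      g (activeCount (extend true r r R))
        ≡⟨ ≡.cong g (≡.trans (activeCount-cong (extend-cong r≗)) (activeCount-extend-block (proj₁ nc2) min₀)) ⟩
      g (joinCount (isActive R) m₀)
        ≡⟨ ≡.sym (if-T (from T-∧ (from T-isActive act₀ , from T-≗ᵇ r≗))) ⟩
      joinTerm r m₀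
        ≡⟨ ≡.sym (∑<-single (joinTerm r) m₀ others) ⟩
      ∑[ m < n ] joinTerm r m
        ≡⟨ ≡.cong (_+ ∑[ m < n ] joinTerm r m) (≡.sym (if-¬T nonempty)) ⟩
      newBlockTerm r + ∑[ m < n ] joinTerm r m ∎
      where
      nonempty : ¬ T (r ≗ᵇ ∅)
      nonempty t = ≡.subst T (to T-≗ᵇ t m₀) (≡.subst T (≡.sym (r≗ m₀)) Eq.refl)
      others : ∀ m → m ≢ m₀ → joinTerm r m ≡ 0
      others m m≢m₀ = if-¬T λ t →
        let (act , r≗ᵇRm) = to T-∧ t
            m₀∼m = ≡.subst T (r≗ m) (≡.subst T (≡.sym (to T-≗ᵇ r≗ᵇRm m)) Eq.refl)
        in m≢m₀ (≡.sym (blockMin-unique (proj₁ nc2) min₀ (proj₁ (to T-isActive act)) m₀∼m))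

    weight-extend : (r : Fin n → Bool) → weight g (extend true r r R) ≡ newBlockTerm r + ∑[ m < n ] joinTerm r m
    weight-extend r with isNC2 (extend true r r R) in ext-nc2
    ... | false = ≡.sym (rejected-terms r λ nc2′ → ≡.subst T ext-nc2 (from T-isNC2 nc2′))
    ... | true with isNC2-extend⁻ (to T-isNC2 (from T-≡ ext-nc2))
    ...   | inj₁ empty            = weight-extend-∅ r empty
    ...   | inj₂ (_ , act₀ , r≗) = weight-extend-block r act₀ r≗

    ∑-weight-extend : ∑[ r ∈ allFuns bools n ] weight g (extend true r r R) ≡ transfer g (activeCount R)
    ∑-weight-extend = begin
      ∑[ r ∈ rows ] weight g (extend true r r R)
        ≡⟨ ∑-cong rows weight-extend ⟩
      ∑[ r ∈ rows ] (newBlockTerm r + ∑[ m < n ] joinTerm r m)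
        ≡⟨ ∑-distrib-+ rows newBlockTerm _ ⟩
      ∑[ r ∈ rows ] newBlockTerm r + ∑[ r ∈ rows ] ∑[ m < n ] joinTerm r m
        ≡⟨ ≡.cong₂ _+_ (∑-allFuns-indicator n ∅ _) (∑-comm-Fin rows n joinTerm) ⟩
      g (suc (activeCount R)) + ∑[ m < n ] ∑[ r ∈ rows ] joinTerm r m
        ≡⟨ ≡.cong (g (suc (activeCount R)) +_) (sum-cong-≗ ∑-joinTerm) ⟩
      g (suc (activeCount R)) + ∑[ m < n ] (if isActive R m then g (joinCount (isActive R) m) else 0)
        ≡⟨ ∑-activeJoin g R ⟩
      transfer g (activeCount R) ∎
      where
      rows = allFuns bools n
      ∑-joinTerm : ∀ m → ∑[ r ∈ rows ] (if isActive R m ∧ (r ≗ᵇ R m) then g (joinCount (isActive R) m) else 0)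
                           ≡ (if isActive R m then g (joinCount (isActive R) m) else 0)
      ∑-joinTerm m with isActive R m
      ... | true  = ∑-allFuns-indicator n (R m) _
      ... | false = ∑-zero rows

  module _ {n : ℕ} (g : ℕ → ℕ) {r c : Fin n → Bool} {R : Rel n} where

    weight-extend-restrict : ¬ IsNC2 R → weight g (extend true r c R) ≡ 0
    weight-extend-restrict ¬nc2 = if-¬T {b = isNC2 (extend true r c R)} λ t →
      ¬nc2 (isNC2-restrict (to (T-isNC2 {R = extend true r c R}) t))

    weight-extend-asym : weight g (extend true r c R) ≡ (if c ≗ᵇ r then weight g (extend true r r R) else 0)
    weight-extend-asym with c ≗ᵇ r in c≟r
    ... | true  = weight-cong g {extend true r c R} {extend true r r R} λ where
      zero    zero    → refl
      zero    (suc j) → refl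
      (suc i) zero    → to T-≗ᵇ (from T-≡ c≟r) i
      (suc i) (suc j) → refl
    ... | false = if-¬T {b = isNC2 (extend true r c R)} λ t →
                    ≡.subst T c≟r (from T-≗ᵇ (extend-sym (proj₁ (to (T-isNC2 {R = extend true r c R}) t))))

  ∑-extensions : {n : ℕ} (g : ℕ → ℕ) (R : Rel n) →
                 ∑[ x ∈ bools ] ∑[ r ∈ allFuns bools n ] ∑[ c ∈ allFuns bools n ] weight g (extend x r c R)
                   ≡ weight (transfer g) R
  ∑-extensions {n} g R = begin
    ∑[ r ∈ rows ] ∑[ c ∈ rows ] weight g (extend true r c R)
      + (∑[ r ∈ rows ] ∑[ c ∈ rows ] weight g (extend false r c R) + 0)
      ≡⟨ ≡.cong₂ _+_ (∑-cong rows λ r → ≡.trans (∑-cong rows λ c → weight-extend-asym g {r} {c} {R})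
                                                (∑-allFuns-indicator n r _))
                     -- isNC2 (extend false r c R) computes to false: the new element is not self-related
                     (≡.cong (_+ 0) (≡.trans (∑-cong rows λ r → ∑-zero rows) (∑-zero rows))) ⟩
    ∑[ r ∈ rows ] weight g (extend true r r R) + 0
      ≡⟨ ℕP.+-identityʳ _ ⟩
    ∑[ r ∈ rows ] weight g (extend true r r R)
      ≡⟨ by-isNC2 ⟩
    weight (transfer g) R ∎
    where
    rows = allFuns bools n
    by-isNC2 : ∑[ r ∈ rows ] weight g (extend true r r R) ≡ weight (transfer g) R
    by-isNC2 with isNC2 R in R-nc2
    ... | true  = ∑-weight-extend g (to (T-isNC2 {R = R}) (from T-≡ R-nc2))
    ... | false = ≡.trans (∑-cong rows λ r → weight-extend-restrict g {r} {r} {R} λ nc2 →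
                                                ≡.subst T R-nc2 (from T-isNC2 nc2))
                          (∑-zero rows)

  weightedCount-suc : (n : ℕ) (g : ℕ → ℕ) → weightedCount (suc n) g ≡ weightedCount n (transfer g)
  weightedCount-suc n g = begin
    ∑[ R ∈ allRels (suc n) ] weight g R
      ≡⟨ ∑-allFuns-suc (allFuns bools (suc n)) n (weight g) ⟩
    ∑[ row ∈ allFuns bools (suc n) ] ∑[ rows′ ∈ allFuns (allFuns bools (suc n)) n ] weight g (row ∷ᶠ rows′)
      ≡⟨ ∑-allFuns-suc bools n _ ⟩
    ∑[ x ∈ bools ] ∑[ r ∈ rows ] ∑[ rows′ ∈ allFuns (allFuns bools (suc n)) n ] weight g ((x ∷ᶠ r) ∷ᶠ rows′)
      ≡⟨ ∑-cong bools (λ x → ∑-cong rows λ r →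
           ∑-allFuns-zip bools rows _∷ᶠ_ n (λ rows′ → weight g ((x ∷ᶠ r) ∷ᶠ rows′)) λ rows≗ →
           weight-cong g λ { zero j → refl ; (suc i) j → ≡.cong (λ row → row j) (rows≗ i) }) ⟩
    ∑[ x ∈ bools ] ∑[ r ∈ rows ] ∑[ c ∈ rows ] ∑[ R ∈ allRels n ] weight g (extend x r c R)
      ≡⟨ ∑-cong bools (λ x → ∑-cong rows λ r → ∑-comm rows (allRels n) λ c R → weight g (extend x r c R)) ⟩
    ∑[ x ∈ bools ] ∑[ r ∈ rows ] ∑[ R ∈ allRels n ] ∑[ c ∈ rows ] weight g (extend x r c R)
      ≡⟨ ∑-cong bools (λ x → ∑-comm rows (allRels n) λ r R → ∑[ c ∈ rows ] weight g (extend x r c R)) ⟩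
    ∑[ x ∈ bools ] ∑[ R ∈ allRels n ] ∑[ r ∈ rows ] ∑[ c ∈ rows ] weight g (extend x r c R)
      ≡⟨ ∑-comm bools (allRels n) (λ x R → ∑[ r ∈ rows ] ∑[ c ∈ rows ] weight g (extend x r c R)) ⟩
    ∑[ R ∈ allRels n ] ∑[ x ∈ bools ] ∑[ r ∈ rows ] ∑[ c ∈ rows ] weight g (extend x r c R)
      ≡⟨ ∑-cong (allRels n) (∑-extensions g) ⟩
    ∑[ R ∈ allRels n ] weight (transfer g) R ∎
    where rows = allFuns bools n

  weightedCount-cong : (n : ℕ) {f g : ℕ → ℕ} → (∀ k → f k ≡ g k) → weightedCount n f ≡ weightedCount n g
  weightedCount-cong n f≗g = ∑-cong (allRels n) λ R → ≡.cong (λ v → if isNC2 R then v else 0) (f≗g (activeCount R))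

  weightedCount-+ : (n : ℕ) (f g : ℕ → ℕ) →
                    weightedCount n (λ k → f k + g k) ≡ weightedCount n f + weightedCount n g
  weightedCount-+ n f g = ≡.trans (∑-cong (allRels n) split) (∑-distrib-+ (allRels n) (weight f) (weight g))
    where
    split : ∀ R → weight (λ k → f k + g k) R ≡ weight f R + weight g R
    split R with isNC2 R
    ... | true  = refl
    ... | false = refl

  weightedCount-* : (n a : ℕ) (f : ℕ → ℕ) → weightedCount n (λ k → a * f k) ≡ a * weightedCount n f
  weightedCount-* n a f = ≡.trans (∑-cong (allRels n) scale) (≡.sym (*-distribˡ-∑ a (allRels n) (weight f)))
    where
    scale : ∀ R → weight (λ k → a * f k) R ≡ a * weight f R
    scale R with isNC2 R
    ... | true  = refl
    ... | false = ≡.sym (ℕP.*-zeroʳ a)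

  basis : ℕ → ℕ → ℕ
  basis zero    zero    = 1
  basis zero    (suc k) = 0
  basis (suc j) zero    = 0
  basis (suc j) (suc k) = k C j

  diagonal : ℕ → ℕ
  diagonal zero    = 2
  diagonal (suc j) = 3

  sum₂-basis-zero : ∀ c → sum₂ (basis 0) c ≡ 0
  sum₂-basis-zero zero    = refl
  sum₂-basis-zero (suc c) = sum₂-basis-zero c

  sum₂-basis-one : ∀ c → sum₂ (basis 1) c ≡ c
  sum₂-basis-one zero    = refl
  sum₂-basis-one (suc c) = ≡.cong suc (sum₂-basis-one c)

  sum₂-basis : ∀ j c → sum₂ (basis (2 + j)) c ≡ suc c C (2 + j)
  sum₂-basis j zero    = refl
  sum₂-basis j (suc c) = ≡.trans (≡.cong (suc c C suc j +_) (sum₂-basis j c)) (nCk+nC[k+1]≡[n+1]C[k+1] (suc c) (suc j))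

  transfer-basis-zero : ∀ k → transfer (basis 0) k ≡ 0
  transfer-basis-zero zero    = refl
  transfer-basis-zero (suc c) = sum₂-basis-zero c

  transfer-basis : ∀ j k → transfer (basis (suc j)) k ≡ basis (2 + j) k + diagonal j * basis (suc j) k + basis j k
  transfer-basis zero    zero    = refl
  transfer-basis (suc j) zero    = refl
  transfer-basis zero    (suc c) rewrite sum₂-basis-one c | nC1≡n c = lemma c
    where
    lemma : ∀ c → 1 + (1 + c) ≡ c + 2 * 1 + 0
    lemma = solve-∀ ℕ-ring
  transfer-basis (suc j) (suc c)
    rewrite sum₂-basis j c
          | ≡.sym (nCk+nC[k+1]≡[n+1]C[k+1] c j)
          | ≡.sym (nCk+nC[k+1]≡[n+1]C[k+1] c (suc j)) = lemma (c C j) (c C suc j) (c C (2 + j))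
    where
    lemma : ∀ x y z → x + y + (y + (y + z)) ≡ z + 3 * y + x
    lemma = solve-∀ ℕ-ring

  weightedCount-basis-zero : (n : ℕ) → weightedCount (suc n) (basis 0) ≡ 0
  weightedCount-basis-zero n = begin
    weightedCount (suc n) (basis 0)    ≡⟨ weightedCount-suc n (basis 0) ⟩
    weightedCount n (transfer (basis 0)) ≡⟨ weightedCount-cong n transfer-basis-zero ⟩
    weightedCount n (λ _ → 0)          ≡⟨ weightedCount-* n 0 (λ _ → 0) ⟩
    0                                  ∎

  weightedCount-basis-suc : (n j : ℕ) →
    weightedCount (suc n) (basis (suc j))
      ≡ weightedCount n (basis (2 + j)) + diagonal j * weightedCount n (basis (suc j)) + weightedCount n (basis j)
  weightedCount-basis-suc n j = begin
    weightedCount (suc n) (basis (suc j))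
      ≡⟨ weightedCount-suc n (basis (suc j)) ⟩
    weightedCount n (transfer (basis (suc j)))
      ≡⟨ weightedCount-cong n (transfer-basis j) ⟩
    weightedCount n (λ k → basis (2 + j) k + diagonal j * basis (suc j) k + basis j k)
      ≡⟨ weightedCount-+ n (λ k → basis (2 + j) k + diagonal j * basis (suc j) k) (basis j) ⟩
    weightedCount n (λ k → basis (2 + j) k + diagonal j * basis (suc j) k) + weightedCount n (basis j)
      ≡⟨ ≡.cong (_+ weightedCount n (basis j)) (weightedCount-+ n (basis (2 + j)) λ k → diagonal j * basis (suc j) k) ⟩
    weightedCount n (basis (2 + j)) + weightedCount n (λ k → diagonal j * basis (suc j) k) + weightedCount n (basis j)
      ≡⟨ ≡.cong (λ v → weightedCount n (basis (2 + j)) + v + weightedCount n (basis j))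
                (weightedCount-* n (diagonal j) (basis (suc j))) ⟩
    weightedCount n (basis (2 + j)) + diagonal j * weightedCount n (basis (suc j)) + weightedCount n (basis j) ∎

  numNC2-basis : (n : ℕ) → numNC2 n ≡ weightedCount n (basis 0) + weightedCount n (basis 1)
  numNC2-basis n = ≡.trans (numNC2≡weightedCount n)
    (≡.trans (weightedCount-cong n {g = λ k → basis 0 k + basis 1 k} λ { zero → refl ; (suc k) → refl })
             (weightedCount-+ n (basis 0) (basis 1)))

-- Weighted Motzkin paths

module Paths (b λ′ : ℕ → ℚ) where

  open import Data.Rational using (_+_; _*_)
  open ListSum (Ring.semiring ℚP.+-*-ring)
  open ≡.≡-Reasoning

  pathTerm : ℕ → List Step → ℚ
  pathTerm h w = if isMotzkinFrom h w then weightFrom b λ′ h w else 0ℚ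

  pathSum : ℕ → ℕ → ℚ
  pathSum n h = ∑[ w ∈ words n ] pathTerm h w

  Mot≡pathSum : (n : ℕ) → Mot n b λ′ ≡ pathSum n 0
  Mot≡pathSum n = ∑-filter (isMotzkinFrom 0) (words n) (weightFrom b λ′ 0)

  ∑-scaled-pathTerm : (n : ℕ) (a : ℚ) (h : ℕ) →
                      ∑[ w ∈ words n ] (if isMotzkinFrom h w then a * weightFrom b λ′ h w else 0ℚ) ≡ a * pathSum n h
  ∑-scaled-pathTerm n a h = ≡.trans (∑-cong (words n) scale) (≡.sym (*-distribˡ-∑ a (words n) (pathTerm h)))
    where
    scale : ∀ w → (if isMotzkinFrom h w then a * weightFrom b λ′ h w else 0ℚ) ≡ a * pathTerm h w
    scale w with isMotzkinFrom h w
    ... | true  = refl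
    ... | false = ≡.sym (ℚP.*-zeroʳ a)

  pathSum-split : (n h : ℕ) → pathSum (suc n) h ≡
    pathSum n (suc h) + (∑[ w ∈ words n ] pathTerm h (D ∷ w) + b h * pathSum n h)
  pathSum-split n h = begin
    ∑[ w ∈ concatMap (λ s → map (s ∷_) (words n)) allSteps ] pathTerm h w
      ≡⟨ ∑-concatMap (λ s → map (s ∷_) (words n)) allSteps (pathTerm h) ⟩
    ∑[ w ∈ map (U ∷_) (words n) ] pathTerm h w + (∑[ w ∈ map (D ∷_) (words n) ] pathTerm h w +
      (∑[ w ∈ map (H ∷_) (words n) ] pathTerm h w + 0ℚ))
      ≡⟨ ≡.cong₂ _+_ (∑-map (U ∷_) (words n) (pathTerm h)) (≡.cong₂ _+_ (∑-map (D ∷_) (words n) (pathTerm h))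
           (≡.trans (ℚP.+-identityʳ _)
                    (≡.trans (∑-map (H ∷_) (words n) (pathTerm h)) (∑-scaled-pathTerm n (b h) h)))) ⟩
    pathSum n (suc h) + (∑[ w ∈ words n ] pathTerm h (D ∷ w) + b h * pathSum n h) ∎

  pathSum-suc-zero : (n : ℕ) → pathSum (suc n) 0 ≡ pathSum n 1 + b 0 * pathSum n 0
  pathSum-suc-zero n = ≡.trans (pathSum-split n 0)
    (≡.cong (pathSum n 1 +_) (≡.trans (≡.cong (_+ b 0 * pathSum n 0) (∑-zero (words n))) (ℚP.+-identityˡ _)))

  pathSum-suc-suc : (n h : ℕ) →
    pathSum (suc n) (suc h) ≡ pathSum n (2 ℕ.+ h) + λ′ h * pathSum n h + b (suc h) * pathSum n (suc h)
  pathSum-suc-suc n h = ≡.trans (pathSum-split n (suc h))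
    (≡.trans (≡.cong (λ v → pathSum n (2 ℕ.+ h) + (v + b (suc h) * pathSum n (suc h))) (∑-scaled-pathTerm n (λ′ h) h))
             (≡.sym (ℚP.+-assoc (pathSum n (2 ℕ.+ h)) (λ′ h * pathSum n h) (b (suc h) * pathSum n (suc h)))))

-- Fibonacci numbers of odd index

module _ where

  open import Data.Nat using (_+_; _*_)
  open ≡.≡-Reasoning

  -- oddFib k = F(2k - 1), using F(-1) = 1.
  oddFib : ℕ → ℕ
  oddFib zero    = 1
  oddFib (suc k) = fib (suc (k + k))

  fib-rec₂ : ∀ x → fib (5 + x) + fib (1 + x) ≡ 3 * fib (3 + x)
  fib-rec₂ x = expand (fib (suc x)) (fib x)
    where
    expand : ∀ u v → (((u + v) + u) + (u + v)) + ((u + v) + u) + u ≡ 3 * ((u + v) + u)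
    expand = solve-∀ ℕ-ring

  oddFib-rec : ∀ k → oddFib (2 + k) + oddFib k ≡ 3 * oddFib (1 + k)
  oddFib-rec zero    = refl
  oddFib-rec (suc j) = ≡.subst₂ (λ a c → fib a + fib (suc (j + j)) ≡ 3 * fib c)
                                 (≡.sym (index₅ j)) (≡.sym (index₃ j)) (fib-rec₂ (j + j))
    where
    index₅ : ∀ j → suc (suc (suc j) + suc (suc j)) ≡ 5 + (j + j)
    index₅ = solve-∀ ℕ-ring
    index₃ : ∀ j → suc (suc j + suc j) ≡ 3 + (j + j)
    index₃ = solve-∀ ℕ-ring

  cassini-step : ∀ X Y Z W → X * Z ≡ Y * Y + 1 → Z + X ≡ 3 * Y → W + Y ≡ 3 * Z →
                 Y * W ≡ Z * Z + 1
  cassini-step X Y Z W XZ Z+X W+Y = ℕP.+-cancelʳ-≡ (Y * Y) (Y * W) (Z * Z + 1) (begin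
    Y * W + Y * Y        ≡⟨ ≡.sym (ℕP.*-distribˡ-+ Y W Y) ⟩
    Y * (W + Y)          ≡⟨ ≡.cong (Y *_) W+Y ⟩
    Y * (3 * Z)          ≡⟨ swap Y Z ⟩
    Z * (3 * Y)          ≡⟨ ≡.cong (Z *_) (≡.sym Z+X) ⟩
    Z * (Z + X)          ≡⟨ ℕP.*-distribˡ-+ Z Z X ⟩
    Z * Z + Z * X        ≡⟨ ≡.cong (Z * Z +_) (≡.trans (ℕP.*-comm Z X) XZ) ⟩
    Z * Z + (Y * Y + 1)  ≡⟨ regroup (Z * Z) (Y * Y) ⟩
    Z * Z + 1 + Y * Y    ∎)
    where
    swap : ∀ Y Z → Y * (3 * Z) ≡ Z * (3 * Y)
    swap = solve-∀ ℕ-ring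
    regroup : ∀ a b → a + (b + 1) ≡ a + 1 + b
    regroup = solve-∀ ℕ-ring

  oddFib-cassini : ∀ k → oddFib k * oddFib (2 + k) ≡ oddFib (1 + k) * oddFib (1 + k) + 1
  oddFib-cassini zero    = refl
  oddFib-cassini (suc k) = cassini-step (oddFib k) (oddFib (1 + k)) (oddFib (2 + k)) (oddFib (3 + k))
                                        (oddFib-cassini k) (oddFib-rec k) (oddFib-rec (suc k))

  oddFib-pos : ∀ k → 0 ℕ.< oddFib k
  oddFib-pos zero    = s≤s z≤n
  oddFib-pos (suc k) = fib-suc-pos (k + k)
    where
    fib-suc-pos : ∀ m → 0 ℕ.< fib (suc m)
    fib-suc-pos zero    = s≤s z≤n
    fib-suc-pos (suc m) = ℕP.<-≤-trans (fib-suc-pos m) (ℕP.m≤m+n (fib (suc m)) (fib m))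

  F-odd : ∀ m → F2n- (suc m) 1 ≡ ℤ.+ oddFib (suc m)
  F-odd m = ≡.cong (λ k → ℤ.+ fib k) (index m)
    where
    index : ∀ m → m + suc (m + 0) ≡ suc (m + m)
    index = solve-∀ ℕ-ring

  F-odd-pred : ∀ m → F2n- (suc m) 3 ≡ ℤ.+ oddFib m
  F-odd-pred zero    = refl
  F-odd-pred (suc m) rewrite ℕP.+-identityʳ m | ℕP.+-suc m (suc m) | ℕP.+-suc m m = refl

-- Rational identities and the comparison of the two recurrences

module _ where

  open import Data.Rational using (_+_; _*_; _-_)
  open ≡.≡-Reasoning

  ℕtoℚ≡mkℚ : ∀ a → ℕtoℚ a ≡ ℚ.mkℚ (ℤ.+ a) 0 (Coprime.sym (Coprime.1-coprimeTo a))
  ℕtoℚ≡mkℚ a = ℚP.normalize-coprime (Coprime.sym (Coprime.1-coprimeTo a))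

  ℕtoℚ-homo-+ : ∀ a b → ℕtoℚ (a ℕ.+ b) ≡ ℕtoℚ a + ℕtoℚ b
  ℕtoℚ-homo-+ a b = ℚP.toℚᵘ-injective
    (ℚᵘP.≃-trans lhs (ℚᵘP.≃-sym (ℚᵘP.≃-trans (ℚP.toℚᵘ-homo-+ (ℕtoℚ a) (ℕtoℚ b)) rhs)))
    where
    lhs : ℚ.toℚᵘ (ℕtoℚ (a ℕ.+ b)) ℚᵘ.≃ ℚᵘ.mkℚᵘ (ℤ.+ (a ℕ.+ b)) 0
    lhs rewrite ℕtoℚ≡mkℚ (a ℕ.+ b) = ℚᵘP.≃-refl
    rhs : ℚ.toℚᵘ (ℕtoℚ a) ℚᵘ.+ ℚ.toℚᵘ (ℕtoℚ b) ℚᵘ.≃ ℚᵘ.mkℚᵘ (ℤ.+ (a ℕ.+ b)) 0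
    rhs rewrite ℕtoℚ≡mkℚ a | ℕtoℚ≡mkℚ b =
      ℚᵘ.*≡* (≡.cong (ℤ._* ℤ.+ 1) (≡.cong₂ ℤ._+_ (ℤP.*-identityʳ (ℤ.+ a)) (ℤP.*-identityʳ (ℤ.+ b))))

  ℕtoℚ-homo-* : ∀ a b → ℕtoℚ (a ℕ.* b) ≡ ℕtoℚ a * ℕtoℚ b
  ℕtoℚ-homo-* a b = ℚP.toℚᵘ-injective
    (ℚᵘP.≃-trans lhs (ℚᵘP.≃-sym (ℚᵘP.≃-trans (ℚP.toℚᵘ-homo-* (ℕtoℚ a) (ℕtoℚ b)) rhs)))
    where
    lhs : ℚ.toℚᵘ (ℕtoℚ (a ℕ.* b)) ℚᵘ.≃ ℚᵘ.mkℚᵘ (ℤ.+ (a ℕ.* b)) 0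
    lhs rewrite ℕtoℚ≡mkℚ (a ℕ.* b) = ℚᵘP.≃-refl
    rhs : ℚ.toℚᵘ (ℕtoℚ a) ℚᵘ.* ℚ.toℚᵘ (ℕtoℚ b) ℚᵘ.≃ ℚᵘ.mkℚᵘ (ℤ.+ (a ℕ.* b)) 0
    rhs rewrite ℕtoℚ≡mkℚ a | ℕtoℚ≡mkℚ b = ℚᵘ.*≡* (≡.cong (ℤ._* ℤ.+ 1) (≡.sym (ℤP.pos-* a b)))

  ℕtoℚ-nonzero : ∀ {a} → 0 ℕ.< a → ℕtoℚ a ≢ 0ℚ
  ℕtoℚ-nonzero {suc a} _ a≡0 with ≡.trans (≡.sym (ℕtoℚ≡mkℚ (suc a))) a≡0
  ... | ()

  inv-inverseʳ : ∀ p → p ≢ 0ℚ → p * inv p ≡ 1ℚ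
  inv-inverseʳ p p≢0 with p ℚ.≟ 0ℚ
  ... | yes p≡0 = ⊥-elim (p≢0 p≡0)
  ... | no  p≢0 = ℚP.*-inverseʳ p {{ℚ.≢-nonZero p≢0}}

  inv-unique : ∀ p q → p * q ≡ 1ℚ → inv p ≡ q
  inv-unique p q pq≡1 = begin
    inv p              ≡⟨ ≡.sym (ℚP.*-identityʳ (inv p)) ⟩
    inv p * 1ℚ         ≡⟨ ≡.cong (inv p *_) (≡.sym pq≡1) ⟩
    inv p * (p * q)    ≡⟨ ≡.sym (ℚP.*-assoc (inv p) p q) ⟩
    inv p * p * q      ≡⟨ ≡.cong (_* q) (≡.trans (ℚP.*-comm (inv p) p) (inv-inverseʳ p p≢0)) ⟩
    1ℚ * q             ≡⟨ ℚP.*-identityˡ q ⟩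
    q                  ∎
    where
    p≢0 : p ≢ 0ℚ
    p≢0 p≡0 with ≡.trans (≡.sym pq≡1) (≡.trans (≡.cong (_* q) p≡0) (ℚP.*-zeroˡ q))
    ... | ()

  ℚ-ring : ACR.AlmostCommutativeRing 0ℓ 0ℓ
  ℚ-ring = ACR.fromCommutativeRing ℚP.+-*-commutativeRing λ x → dec⇒maybe (0ℚ ℚ.≟ x)

  three : ℚ
  three = ℕtoℚ 3

  ratio-cassini : ∀ A B C iA iB → A * iA ≡ 1ℚ → B * iB ≡ 1ℚ → A * C ≡ B * B + 1ℚ → C * iB ≡ B * iA + iB * iA
  ratio-cassini A B C iA iB AiA BiB AC = begin
    C * iB                      ≡⟨ ≡.sym (ℚP.*-identityʳ _) ⟩
    C * iB * 1ℚ                 ≡⟨ ≡.cong (C * iB *_) (≡.sym AiA) ⟩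
    C * iB * (A * iA)           ≡⟨ regroup₁ A C iA iB ⟩
    A * C * (iB * iA)           ≡⟨ ≡.cong (_* (iB * iA)) AC ⟩
    (B * B + 1ℚ) * (iB * iA)    ≡⟨ regroup₂ B iA iB ⟩
    B * iA * (B * iB) + iB * iA ≡⟨ ≡.cong (λ u → B * iA * u + iB * iA) BiB ⟩
    B * iA * 1ℚ + iB * iA       ≡⟨ ≡.cong (_+ iB * iA) (ℚP.*-identityʳ (B * iA)) ⟩
    B * iA + iB * iA            ∎
    where
    regroup₁ : ∀ A C iA iB → C * iB * (A * iA) ≡ A * C * (iB * iA)
    regroup₁ = solve-∀ ℚ-ring
    regroup₂ : ∀ B iA iB → (B * B + 1ℚ) * (iB * iA) ≡ B * iA * (B * iB) + iB * iA
    regroup₂ = solve-∀ ℚ-ring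

  ratio-bSeq-identity : ∀ A B C iA iB → A * iA ≡ 1ℚ → B * iB ≡ 1ℚ → A * C ≡ B * B + 1ℚ →
                        C * iB + (three - iB * iA) ≡ B * iA + three
  ratio-bSeq-identity A B C iA iB AiA BiB AC =
    ≡.trans (≡.cong (_+ (three - iB * iA)) (ratio-cassini A B C iA iB AiA BiB AC)) (cancel (B * iA) (iB * iA))
    where
    cancel : ∀ x y → x + y + (three - y) ≡ x + three
    cancel = solve-∀ ℚ-ring

  λSeq-bSeq-identity : ∀ B iA iB → B * iB ≡ 1ℚ → 1ℚ + iA * iA + (three - iB * iA) * (B * iA) ≡ B * iA * three + 1ℚ
  λSeq-bSeq-identity B iA iB BiB = begin
    1ℚ + iA * iA + (three - iB * iA) * (B * iA)      ≡⟨ expand B iA iB ⟩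
    B * iA * three + 1ℚ + iA * iA * (1ℚ - B * iB)    ≡⟨ ≡.cong (λ u → B * iA * three + 1ℚ + iA * iA * (1ℚ - u)) BiB ⟩
    B * iA * three + 1ℚ + iA * iA * (1ℚ - 1ℚ)        ≡⟨ collapse B iA ⟩
    B * iA * three + 1ℚ                               ∎
    where
    expand : ∀ B iA iB → 1ℚ + iA * iA + (three - iB * iA) * (B * iA) ≡ B * iA * three + 1ℚ + iA * iA * (1ℚ - B * iB)
    expand = solve-∀ ℚ-ring
    collapse : ∀ B iA → B * iA * three + 1ℚ + iA * iA * (1ℚ - 1ℚ) ≡ B * iA * three + 1ℚ
    collapse = solve-∀ ℚ-ring

  λSeq-ratio-identity : ∀ A B O iA iO → A * iA ≡ 1ℚ → O * iO ≡ 1ℚ → O * B ≡ A * A + 1ℚ →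
                        (1ℚ + iA * iA) * (A * iO) ≡ B * iA
  λSeq-ratio-identity A B O iA iO AiA OiO OB = begin
    (1ℚ + iA * iA) * (A * iO)     ≡⟨ regroup₁ A iA iO ⟩
    (A + iA * (A * iA)) * iO      ≡⟨ ≡.cong (λ u → (A + iA * u) * iO) AiA ⟩
    (A + iA * 1ℚ) * iO            ≡⟨ regroup₂ A iA iO ⟩
    (A * 1ℚ + iA) * iO            ≡⟨ ≡.cong (λ u → (A * u + iA) * iO) (≡.sym AiA) ⟩
    (A * (A * iA) + iA) * iO      ≡⟨ regroup₃ A iA iO ⟩
    (A * A + 1ℚ) * iA * iO        ≡⟨ ≡.cong (λ u → u * iA * iO) (≡.sym OB) ⟩
    O * B * iA * iO               ≡⟨ regroup₄ B O iA iO ⟩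
    B * iA * (O * iO)             ≡⟨ ≡.cong (B * iA *_) OiO ⟩
    B * iA * 1ℚ                   ≡⟨ ℚP.*-identityʳ (B * iA) ⟩
    B * iA                        ∎
    where
    regroup₁ : ∀ A iA iO → (1ℚ + iA * iA) * (A * iO) ≡ (A + iA * (A * iA)) * iO
    regroup₁ = solve-∀ ℚ-ring
    regroup₂ : ∀ A iA iO → (A + iA * 1ℚ) * iO ≡ (A * 1ℚ + iA) * iO
    regroup₂ = solve-∀ ℚ-ring
    regroup₃ : ∀ A iA iO → (A * (A * iA) + iA) * iO ≡ (A * A + 1ℚ) * iA * iO
    regroup₃ = solve-∀ ℚ-ring
    regroup₄ : ∀ B O iA iO → O * B * iA * iO ≡ B * iA * (O * iO)
    regroup₄ = solve-∀ ℚ-ring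

  gauge-step : ∀ c₀ c₁ c₂ d₀ d₁ β l → c₂ + β ≡ c₁ + d₁ → l + β * c₁ ≡ c₁ * d₀ + 1ℚ → l * c₀ ≡ c₁ →
                  ∀ y₀ y₁ y₂ y₃ → c₁ * (y₂ + d₀ * y₁ + y₀) + (y₃ + d₁ * y₂ + y₁)
                                    ≡ c₂ * y₂ + y₃ + l * (c₀ * y₀ + y₁) + β * (c₁ * y₁ + y₂)
  gauge-step c₀ c₁ c₂ d₀ d₁ β l h₂ h₁ h₀ y₀ y₁ y₂ y₃ = ≡.sym (begin
    c₂ * y₂ + y₃ + l * (c₀ * y₀ + y₁) + β * (c₁ * y₁ + y₂)
      ≡⟨ expand c₀ c₁ c₂ β l y₀ y₁ y₂ y₃ ⟩
    (c₂ + β) * y₂ + (l + β * c₁) * y₁ + l * c₀ * y₀ + y₃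
      ≡⟨ ≡.cong₂ (λ u v → u * y₂ + v * y₁ + l * c₀ * y₀ + y₃) h₂ h₁ ⟩
    (c₁ + d₁) * y₂ + (c₁ * d₀ + 1ℚ) * y₁ + l * c₀ * y₀ + y₃
      ≡⟨ ≡.cong (λ u → (c₁ + d₁) * y₂ + (c₁ * d₀ + 1ℚ) * y₁ + u * y₀ + y₃) h₀ ⟩
    (c₁ + d₁) * y₂ + (c₁ * d₀ + 1ℚ) * y₁ + c₁ * y₀ + y₃
      ≡⟨ collect c₁ d₀ d₁ y₀ y₁ y₂ y₃ ⟩
    c₁ * (y₂ + d₀ * y₁ + y₀) + (y₃ + d₁ * y₂ + y₁) ∎)
    where
    expand : ∀ c₀ c₁ c₂ β l y₀ y₁ y₂ y₃ → c₂ * y₂ + y₃ + l * (c₀ * y₀ + y₁) + β * (c₁ * y₁ + y₂)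
                                          ≡ (c₂ + β) * y₂ + (l + β * c₁) * y₁ + l * c₀ * y₀ + y₃
    expand = solve-∀ ℚ-ring
    collect : ∀ c₁ d₀ d₁ y₀ y₁ y₂ y₃ → (c₁ + d₁) * y₂ + (c₁ * d₀ + 1ℚ) * y₁ + c₁ * y₀ + y₃
                                         ≡ c₁ * (y₂ + d₀ * y₁ + y₀) + (y₃ + d₁ * y₂ + y₁)
    collect = solve-∀ ℚ-ring

  oddFibℚ : ℕ → ℚ
  oddFibℚ k = ℕtoℚ (oddFib k)

  oddFibℚ⁻¹ : ℕ → ℚ
  oddFibℚ⁻¹ k = inv (oddFibℚ k)

  oddFibℚ-inverse : ∀ k → oddFibℚ k * oddFibℚ⁻¹ k ≡ 1ℚ
  oddFibℚ-inverse k = inv-inverseʳ (oddFibℚ k) (ℕtoℚ-nonzero (oddFib-pos k))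

  oddFibℚ-cassini : ∀ k → oddFibℚ k * oddFibℚ (2 ℕ.+ k) ≡ oddFibℚ (1 ℕ.+ k) * oddFibℚ (1 ℕ.+ k) + 1ℚ
  oddFibℚ-cassini k = begin
    oddFibℚ k * oddFibℚ (2 ℕ.+ k)                           ≡⟨ ≡.sym (ℕtoℚ-homo-* (oddFib k) _) ⟩
    ℕtoℚ (oddFib k ℕ.* oddFib (2 ℕ.+ k))                    ≡⟨ ≡.cong ℕtoℚ (oddFib-cassini k) ⟩
    ℕtoℚ (oddFib (1 ℕ.+ k) ℕ.* oddFib (1 ℕ.+ k) ℕ.+ 1)     ≡⟨ ℕtoℚ-homo-+ (oddFib (1 ℕ.+ k) ℕ.* oddFib (1 ℕ.+ k)) 1 ⟩
    ℕtoℚ (oddFib (1 ℕ.+ k) ℕ.* oddFib (1 ℕ.+ k)) + 1ℚ      ≡⟨ ≡.cong (_+ 1ℚ) (ℕtoℚ-homo-* (oddFib (1 ℕ.+ k)) _) ⟩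
    oddFibℚ (1 ℕ.+ k) * oddFibℚ (1 ℕ.+ k) + 1ℚ              ∎

  inv-oddFib-* : ∀ a c → inv (toℚ (ℤ.+ oddFib a ℤ.* ℤ.+ oddFib c)) ≡ oddFibℚ⁻¹ a * oddFibℚ⁻¹ c
  inv-oddFib-* a c = ≡.trans (≡.cong (inv ∘ toℚ) (≡.sym (ℤP.pos-* (oddFib a) (oddFib c))))
    (inv-unique (ℕtoℚ (oddFib a ℕ.* oddFib c)) (oddFibℚ⁻¹ a * oddFibℚ⁻¹ c) (begin
    ℕtoℚ (oddFib a ℕ.* oddFib c) * (oddFibℚ⁻¹ a * oddFibℚ⁻¹ c)
      ≡⟨ ≡.cong (_* (oddFibℚ⁻¹ a * oddFibℚ⁻¹ c)) (ℕtoℚ-homo-* (oddFib a) (oddFib c)) ⟩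
    oddFibℚ a * oddFibℚ c * (oddFibℚ⁻¹ a * oddFibℚ⁻¹ c)
      ≡⟨ regroup (oddFibℚ a) (oddFibℚ c) (oddFibℚ⁻¹ a) (oddFibℚ⁻¹ c) ⟩
    oddFibℚ a * oddFibℚ⁻¹ a * (oddFibℚ c * oddFibℚ⁻¹ c)
      ≡⟨ ≡.cong₂ _*_ (oddFibℚ-inverse a) (oddFibℚ-inverse c) ⟩
    1ℚ * 1ℚ ∎))
    where
    regroup : ∀ x y u v → x * y * (u * v) ≡ x * u * (y * v)
    regroup = solve-∀ ℚ-ring

  bSeq-suc : ∀ m → bSeq (suc m) ≡ three - oddFibℚ⁻¹ (suc m) * oddFibℚ⁻¹ m
  bSeq-suc m = ≡.trans (≡.cong₂ (λ a c → three - inv (toℚ (a ℤ.* c))) (F-odd m) (F-odd-pred m))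
                       (≡.cong (three -_) (inv-oddFib-* (suc m) m))

  λSeq-suc : ∀ m → λSeq (suc m) ≡ 1ℚ + oddFibℚ⁻¹ (suc m) * oddFibℚ⁻¹ (suc m)
  λSeq-suc m = ≡.trans (≡.cong (λ a → 1ℚ + inv (toℚ (a ℤ.* a))) (F-odd m))
                       (≡.cong (1ℚ +_) (inv-oddFib-* (suc m) (suc m)))

  ratio : ℕ → ℚ
  ratio zero    = 1ℚ
  ratio (suc h) = oddFibℚ (suc h) * oddFibℚ⁻¹ h

  ratio-bSeq : ∀ m → ratio (2 ℕ.+ m) + bSeq (suc m) ≡ ratio (suc m) + ℕtoℚ (Counting.diagonal (suc m))
  ratio-bSeq m = ≡.trans (≡.cong (ratio (2 ℕ.+ m) +_) (bSeq-suc m))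
    (ratio-bSeq-identity (oddFibℚ m) (oddFibℚ (suc m)) (oddFibℚ (2 ℕ.+ m)) (oddFibℚ⁻¹ m) (oddFibℚ⁻¹ (suc m))
                         (oddFibℚ-inverse m) (oddFibℚ-inverse (suc m)) (oddFibℚ-cassini m))

  λSeq-bSeq : ∀ m → λSeq m + bSeq (suc m) * ratio (suc m) ≡ ratio (suc m) * ℕtoℚ (Counting.diagonal m) + 1ℚ
  λSeq-bSeq zero    = refl
  λSeq-bSeq (suc m) = ≡.trans (≡.cong₂ (λ l b → l + b * ratio (2 ℕ.+ m)) (λSeq-suc m) (bSeq-suc (suc m)))
    (λSeq-bSeq-identity (oddFibℚ (2 ℕ.+ m)) (oddFibℚ⁻¹ (suc m)) (oddFibℚ⁻¹ (2 ℕ.+ m)) (oddFibℚ-inverse (2 ℕ.+ m)))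

  λSeq-ratio : ∀ m → λSeq m * ratio m ≡ ratio (suc m)
  λSeq-ratio zero    = refl
  λSeq-ratio (suc m) = ≡.trans (≡.cong (_* ratio (suc m)) (λSeq-suc m))
    (λSeq-ratio-identity (oddFibℚ (suc m)) (oddFibℚ (2 ℕ.+ m)) (oddFibℚ m) (oddFibℚ⁻¹ (suc m)) (oddFibℚ⁻¹ m)
                         (oddFibℚ-inverse (suc m)) (oddFibℚ-inverse m) (oddFibℚ-cassini m))

  open Counting using (weightedCount; basis; diagonal; weightedCount-basis-zero; weightedCount-basis-suc)
  open Paths bSeq λSeq using (pathSum; pathSum-suc-zero; pathSum-suc-suc)

  basisCount : ℕ → ℕ → ℚ
  basisCount n j = ℕtoℚ (weightedCount n (basis j))

  basisCount-suc : ∀ n j → basisCount (suc n) (suc j)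
                             ≡ basisCount n (2 ℕ.+ j) + ℕtoℚ (diagonal j) * basisCount n (suc j) + basisCount n j
  basisCount-suc n j = ≡.trans (≡.cong ℕtoℚ (weightedCount-basis-suc n j))
    (≡.trans (ℕtoℚ-homo-+ (wc (2 ℕ.+ j) ℕ.+ diagonal j ℕ.* wc (suc j)) (wc j))
      (≡.cong (_+ basisCount n j) (≡.trans (ℕtoℚ-homo-+ (wc (2 ℕ.+ j)) (diagonal j ℕ.* wc (suc j)))
        (≡.cong (basisCount n (2 ℕ.+ j) +_) (ℕtoℚ-homo-* (diagonal j) (wc (suc j)))))))
    where
    wc : ℕ → ℕ
    wc i = weightedCount n (basis i)

  pathSum′ : ℕ → ℕ → ℚ
  pathSum′ n h = ratio h * basisCount n h + basisCount n (suc h)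

  pathSum′-suc-zero : ∀ n → pathSum′ (suc n) 0 ≡ pathSum′ n 1 + bSeq 0 * pathSum′ n 0
  pathSum′-suc-zero n =
    ≡.trans (≡.cong₂ (λ u v → 1ℚ * u + v) (≡.cong ℕtoℚ (weightedCount-basis-zero n)) (basisCount-suc n 0))
                         (regroup (basisCount n 0) (basisCount n 1) (basisCount n 2))
    where
    regroup : ∀ y₀ y₁ y₂ → 1ℚ * 0ℚ + (y₂ + ℕtoℚ 2 * y₁ + y₀) ≡ 1ℚ * y₁ + y₂ + 1ℚ * (1ℚ * y₀ + y₁)
    regroup = solve-∀ ℚ-ring

  pathSum′-suc-suc : ∀ n m →
    pathSum′ (suc n) (suc m) ≡ pathSum′ n (2 ℕ.+ m) + λSeq m * pathSum′ n m + bSeq (suc m) * pathSum′ n (suc m)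
  pathSum′-suc-suc n m =
    ≡.trans (≡.cong₂ (λ u v → ratio (suc m) * u + v) (basisCount-suc n m) (basisCount-suc n (suc m)))
    (gauge-step (ratio m) (ratio (suc m)) (ratio (2 ℕ.+ m)) (ℕtoℚ (diagonal m)) (ℕtoℚ (diagonal (suc m)))
                   (bSeq (suc m)) (λSeq m) (ratio-bSeq m) (λSeq-bSeq m) (λSeq-ratio m)
                   (basisCount n m) (basisCount n (suc m)) (basisCount n (2 ℕ.+ m)) (basisCount n (3 ℕ.+ m)))

  pathSum′≡pathSum : ∀ n h → pathSum′ n h ≡ pathSum n h
  pathSum′≡pathSum zero    zero    = refl
  pathSum′≡pathSum zero    (suc h) = ≡.trans (ℚP.+-identityʳ _) (ℚP.*-zeroʳ (ratio (suc h)))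
  pathSum′≡pathSum (suc n) zero    = begin
    pathSum′ (suc n) 0                    ≡⟨ pathSum′-suc-zero n ⟩
    pathSum′ n 1 + bSeq 0 * pathSum′ n 0  ≡⟨ ≡.cong₂ (λ u v → u + bSeq 0 * v) (pathSum′≡pathSum n 1) (pathSum′≡pathSum n 0) ⟩
    pathSum n 1 + bSeq 0 * pathSum n 0    ≡⟨ ≡.sym (pathSum-suc-zero n) ⟩
    pathSum (suc n) 0                     ∎
  pathSum′≡pathSum (suc n) (suc m) = begin
    pathSum′ (suc n) (suc m)
      ≡⟨ pathSum′-suc-suc n m ⟩
    pathSum′ n (2 ℕ.+ m) + λSeq m * pathSum′ n m + bSeq (suc m) * pathSum′ n (suc m)
      ≡⟨ ≡.cong₂ _+_ (≡.cong₂ (λ u v → u + λSeq m * v) (pathSum′≡pathSum n (2 ℕ.+ m)) (pathSum′≡pathSum n m))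
                     (≡.cong (bSeq (suc m) *_) (pathSum′≡pathSum n (suc m))) ⟩
    pathSum n (2 ℕ.+ m) + λSeq m * pathSum n m + bSeq (suc m) * pathSum n (suc m)
      ≡⟨ ≡.sym (pathSum-suc-suc n m) ⟩
    pathSum (suc n) (suc m) ∎

theorem1p1 : (n : ℕ) → ℕtoℚ (numNC2 n) ≡ Mot n bSeq λSeq
theorem1p1 n = begin
  ℕtoℚ (numNC2 n)                         ≡⟨ ≡.cong ℕtoℚ (numNC2-basis n) ⟩
  ℕtoℚ (q 0 ℕ.+ q 1)                      ≡⟨ ℕtoℚ-homo-+ (q 0) (q 1) ⟩
  basisCount n 0 ℚ.+ basisCount n 1       ≡⟨ ≡.cong (ℚ._+ basisCount n 1) (≡.sym (ℚP.*-identityˡ (basisCount n 0))) ⟩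
  pathSum′ n 0                            ≡⟨ pathSum′≡pathSum n 0 ⟩
  Paths.pathSum bSeq λSeq n 0             ≡⟨ ≡.sym (Paths.Mot≡pathSum bSeq λSeq n) ⟩
  Mot n bSeq λSeq                         ∎
  where
  open ≡.≡-Reasoning
  open Counting using (weightedCount; basis; numNC2-basis)
  q : ℕ → ℕ
  q j = weightedCount n (basis j)
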